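{- Let $k\ge1$, let $t_1,\dots,t_k$ be integers, let $\mathbf{A}$ be the companion matrix of $\mathcal{C}(X)=X^k-t_1X^{k-1}-\dots-t_k$, and let $d=(d_1,\dots,d_k)$ be the coefficient vector of the derivative $\mathcal{C}'(X)=kX^{k-1}-\sum_{j=1}^{k-1}(k-j)t_jX^{k-j-1}$ in the basis $1,X,\dots,X^{k-1}$, i.e. $d=(-t_{k-1},-2t_{k-2},\dots,-(k-1)t_1,k)$. Then for every integer $n\ge0$, the last (i.e. $k$-th) component of the row vector $d\,\mathbf{A}^n$ equals $G_{k,n}(t_1,\dots,t_k)$, which also equals $\operatorname{tr}(\mathbf{A}^n)$. (In particular the same holds modulo every prime $p$.)
   Context: The companion matrix $\mathbf{A}$ has $\mathbf{A}_{i,i+1}=1$ for $1\le i\le k-1$, last row $(t_k,t_{k-1},\dots,t_1)$, zeros elsewhere; row vectors are multiplied by $\mathbf{A}$ on the right. The generalized Lucas polynomials are $G_{k,n}(t_1,\dots,t_k)=\sum_{\alpha}\frac{n}{|\alpha|}\binom{|\alpha|}{\alpha_1,\dots,\alpha_k}t_1^{\alpha_1}\cdots t_k^{\alpha_k}$ for $n\ge1$, summed over $\alpha\in\mathbb{Z}_{\ge0}^k$ with $\sum_jj\alpha_j=n$, $|\alpha|=\sum_j\alpha_j$; and $G_{k,0}=k$. -}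

module Defs where

open import Data.Nat as ℕ using (ℕ; zero; suc; _∸_; _≟_)
open import Data.Nat.Combinatorics using (_C_)
open import Data.Integer as ℤ using (ℤ; +_)
open import Data.Rational as ℚ using (ℚ)
open import Data.Fin using (Fin; toℕ; fromℕ)
import Data.Fin as F
open import Data.Vec using (Vec; []; _∷_)
open import Data.List as List using (List; []; _∷_; filter; concatMap; upTo)
open import Relation.Nullary.Decidable using (does)
open import Data.Bool using (if_then_else_)

sumFin : ∀ {A : Set} → (A → A → A) → A → (n : ℕ) → (Fin n → A) → A
sumFin _⊕_ e zero    f = e
sumFin _⊕_ e (suc n) f = f F.zero ⊕ sumFin _⊕_ e n (λ i → f (F.suc i))

Σℤ : (n : ℕ) → (Fin n → ℤ) → ℤ
Σℤ = sumFin ℤ._+_ (+ 0)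

Matrix : ℕ → Set
Matrix k = Fin k → Fin k → ℤ

identity : ∀ {k} → Matrix k
identity i j = if does (toℕ i ≟ toℕ j) then + 1 else + 0

_⊗_ : ∀ {k} → Matrix k → Matrix k → Matrix k
_⊗_ {k} M N i j = Σℤ k (λ l → M i l ℤ.* N l j)

_^ᴹ_ : ∀ {k} → Matrix k → ℕ → Matrix k
M ^ᴹ zero  = identity
M ^ᴹ suc n = (M ^ᴹ n) ⊗ M

_·ᴹ_ : ∀ {k} → (Fin k → ℤ) → Matrix k → (Fin k → ℤ)
_·ᴹ_ {k} v M j = Σℤ k (λ i → v i ℤ.* M i j)

trace : ∀ {k} → Matrix k → ℤ
trace {k} M = Σℤ k (λ i → M i i)

-- Coefficients t = (t₁,…,t_k) given as a vector; coef t j = t_j for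
-- 1 ≤ j ≤ k and 0 otherwise.

coef : ∀ {k} → Vec ℤ k → ℕ → ℤ
coef []       _             = + 0
coef (x ∷ xs) zero          = + 0
coef (x ∷ xs) (suc zero)    = x
coef (x ∷ xs) (suc (suc j)) = coef xs (suc j)

-- Companion matrix of X^k - t₁X^{k-1} - … - t_k, with k = suc m.
-- (0-indexed) A i (i+1) = 1 for i < m; last row (t_k, t_{k-1}, …, t_1).
companion : ∀ {m} → Vec ℤ (suc m) → Matrix (suc m)
companion {m} t i j =
  if does (toℕ i ≟ m)
  then coef t (suc m ∸ toℕ j)
  else (if does (toℕ j ≟ suc (toℕ i)) then + 1 else + 0)

-- Coefficient vector of C'(X) in the basis 1, X, …, X^{k-1}:
-- d = (-t_{k-1}, -2 t_{k-2}, …, -(k-1) t_1, k).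
derivCoeffs : ∀ {m} → Vec ℤ (suc m) → Fin (suc m) → ℤ
derivCoeffs {m} t i =
  if does (toℕ i ≟ m)
  then + suc m
  else ℤ.- (+ suc (toℕ i) ℤ.* coef t (m ∸ toℕ i))

boundedVecs : (k n : ℕ) → List (Vec ℕ k)
boundedVecs zero    n = [] ∷ []
boundedVecs (suc k) n =
  concatMap (λ a → List.map (a ∷_) (boundedVecs k n)) (upTo (suc n))

weightFrom : ∀ {k} → ℕ → Vec ℕ k → ℕ
weightFrom j []       = 0
weightFrom j (a ∷ as) = j ℕ.* a ℕ.+ weightFrom (suc j) as

weight : ∀ {k} → Vec ℕ k → ℕ
weight = weightFrom 1

size : ∀ {k} → Vec ℕ k → ℕ
size []       = 0
size (a ∷ as) = a ℕ.+ size as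

multinomial : ∀ {k} → Vec ℕ k → ℕ
multinomial []       = 1
multinomial (a ∷ as) = ((a ℕ.+ size as) C a) ℕ.* multinomial as

monomialFrom : ∀ {k l} → ℕ → Vec ℤ l → Vec ℕ k → ℤ
monomialFrom j t []       = + 1
monomialFrom j t (a ∷ as) = (coef t j ℤ.^ a) ℤ.* monomialFrom (suc j) t as

-- n / |α| as a rational (|α| = 0 never occurs for n ≥ 1)
ratio : ℕ → ℕ → ℚ
ratio n zero      = ℚ.0ℚ
ratio n (suc s)   = (+ n) ℚ./ suc s

lucasTerm : ∀ {m} → Vec ℤ (suc m) → ℕ → Vec ℕ (suc m) → ℚ
lucasTerm t n α =
  ratio n (size α) ℚ.* (ℚ._/_ (+ multinomial α) 1)
                   ℚ.* (ℚ._/_ (monomialFrom 1 t α) 1)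

G : ∀ {m} → Vec ℤ (suc m) → ℕ → ℚ
G {m} t zero      = ℚ._/_ (+ suc m) 1
G {m} t n@(suc _) =
  List.foldr ℚ._+_ ℚ.0ℚ
    (List.map (lucasTerm t n)
      (filter (λ α → weight α ≟ n) (boundedVecs (suc m) n)))

{-# OPTIONS --safe #-}
-- Both sides satisfy Newton's identities
--   x (n + 1) = Σ_{i<n} t_{i+1} x (n − i) + (n + 1) t_{n+1}    (t_j = 0 for j > k),
-- which determine a sequence from its first term.
-- For G: the coefficients P_w = Σ_{weight α = w} (|α| choose α) t^α of 1 / (1 − Σ tᵢ Xⁱ) satisfy
-- P_w = Σᵢ tᵢ P_{w−i} by the recurrence of multinomial coefficients, and the identity
-- |α| · Σᵢ i (|α| − 1 choose α − eᵢ) = weight α · (|α| choose α) rewrites G_n as Σᵢ i tᵢ P_{n−i},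
-- a convolution that satisfies Newton's identities.
-- For d Aⁿ: column j of A is e_{j−1} + t_{k−j} e_k, so the last entry of d Aⁿ⁺¹ unrolls into the
-- identities, the entries of d supplying the term (n + 1) t_{n+1}. Summation by parts along the
-- diagonal of Aⁿ, where (Aⁿ)_{i+1,i+1} = (Aⁿ)_{i,i} + t_{k−i} (Aⁿ)_{i,k} (1-indexed), shows that the
-- same entry is tr Aⁿ.

module Submission where

open import Defs
import Data.Nat as ℕ
open import Data.Nat using (ℕ; zero; suc; _∸_; z≤n; s≤s; _≤_; _<_; _≤?_; _<?_; _≟_)
import Data.Nat.Properties as ℕₚ
open import Data.Integer using (ℤ; +_; 0ℤ; _+_; _*_; -_; _-_; _^_)
import Data.Integer.Properties as ℤₚ
open import Algebra.Properties.CommutativeSemigroup ℤₚ.+-commutativeSemigroup using (interchange)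
open import Algebra.Properties.CommutativeSemigroup ℤₚ.*-commutativeSemigroup
  using () renaming (x∙yz≈y∙xz to x*[y*z]≡y*[x*z]; xy∙z≈y∙xz to [x*y]*z≡y*[x*z])
open import Data.Integer.Tactic.RingSolver using (solve-∀)
open import Data.Nat.Tactic.RingSolver renaming (solve-∀ to ℕ-solve-∀)
open import Data.Nat.Combinatorics using (_C_; nC1≡n; nCk≡nC[n∸k]; nCk+nC[k+1]≡[n+1]C[k+1])
open import Data.Bool using (if_then_else_)
open import Data.Product using (_×_; _,_)
open import Data.Vec using (Vec; []; _∷_; replicate)
import Data.Fin as Fin
open import Data.Fin using (Fin; toℕ; fromℕ; fromℕ<)
import Data.Fin.Properties as Finₚ
open import Data.List using (List; []; _∷_; _++_; map; filter; concatMap; applyUpTo; upTo; foldr)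
open import Data.Rational as ℚ using (ℚ; _/_; 0ℚ; toℚᵘ)
import Data.Rational.Properties as ℚₚ
import Data.Rational.Unnormalised as ℚᵘ
import Data.Rational.Unnormalised.Properties as ℚᵘₚ
open import Data.Empty using (⊥-elim)
open import Function using (id; _∘_; _⟨_⟩_)
open import Data.Nat.Induction using (<-rec)
open import Relation.Nullary using (¬_; Dec; yes; no; does)
open import Relation.Unary using (Decidable)
open import Relation.Binary.PropositionalEquality
  using (_≡_; _≢_; refl; sym; trans; cong; cong₂; subst; module ≡-Reasoning)
open ≡-Reasoning

private
  variable
    P : Set
    k : ℕ

∑ : ℕ → (ℕ → ℤ) → ℤ
∑ zero    f = 0ℤ
∑ (suc n) f = f 0 + ∑ n (λ i → f (suc i))

infixr 10 ∑
syntax ∑ n (λ i → x) = ∑[ i < n ] x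

∑-cong-< : ∀ n {f g : ℕ → ℤ} → (∀ i → i < n → f i ≡ g i) → ∑ n f ≡ ∑ n g
∑-cong-< zero    eq = refl
∑-cong-< (suc n) eq = cong₂ _+_ (eq 0 (s≤s z≤n)) (∑-cong-< n (λ i i<n → eq (suc i) (s≤s i<n)))

∑-cong : ∀ n {f g : ℕ → ℤ} → (∀ i → f i ≡ g i) → ∑ n f ≡ ∑ n g
∑-cong n eq = ∑-cong-< n (λ i _ → eq i)

∑-zero : ∀ n {f : ℕ → ℤ} → (∀ i → i < n → f i ≡ 0ℤ) → ∑ n f ≡ 0ℤ
∑-zero zero    eq = refl
∑-zero (suc n) eq = cong₂ _+_ (eq 0 (s≤s z≤n)) (∑-zero n (λ i i<n → eq (suc i) (s≤s i<n)))

∑-distrib-+ : ∀ n (f g : ℕ → ℤ) → ∑[ i < n ] (f i + g i) ≡ ∑ n f + ∑ n g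
∑-distrib-+ zero    f g = refl
∑-distrib-+ (suc n) f g = begin
  (f 0 + g 0) + ∑[ i < n ] (f (suc i) + g (suc i))
    ≡⟨ cong (_+_ (f 0 + g 0)) (∑-distrib-+ n _ _) ⟩
  (f 0 + g 0) + (∑[ i < n ] f (suc i) + ∑[ i < n ] g (suc i))
    ≡⟨ interchange (f 0) (g 0) _ _ ⟩
  (f 0 + ∑[ i < n ] f (suc i)) + (g 0 + ∑[ i < n ] g (suc i)) ∎

∑-*ˡ : ∀ n c (f : ℕ → ℤ) → ∑[ i < n ] (c * f i) ≡ c * ∑ n f
∑-*ˡ zero    c f = sym (ℤₚ.*-zeroʳ c)
∑-*ˡ (suc n) c f = cong (_+_ (c * f 0)) (∑-*ˡ n c _) ⟨ trans ⟩ sym (ℤₚ.*-distribˡ-+ c (f 0) _)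

∑-*ʳ : ∀ n c (f : ℕ → ℤ) → ∑[ i < n ] (f i * c) ≡ ∑ n f * c
∑-*ʳ n c f = ∑-cong n (λ i → ℤₚ.*-comm (f i) c) ⟨ trans ⟩ ∑-*ˡ n c f ⟨ trans ⟩ ℤₚ.*-comm c _

∑-neg : ∀ n (f : ℕ → ℤ) → ∑[ i < n ] (- f i) ≡ - ∑ n f
∑-neg zero    f = refl
∑-neg (suc n) f = cong (_+_ (- f 0)) (∑-neg n _) ⟨ trans ⟩ sym (ℤₚ.neg-distrib-+ (f 0) _)

∑-last : ∀ n (f : ℕ → ℤ) → ∑ (suc n) f ≡ ∑ n f + f n
∑-last zero    f = ℤₚ.+-comm (f 0) 0ℤ
∑-last (suc n) f = cong (_+_ (f 0)) (∑-last n _) ⟨ trans ⟩ sym (ℤₚ.+-assoc (f 0) _ _)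

∑-split : ∀ a b (f : ℕ → ℤ) → ∑ (a ℕ.+ b) f ≡ ∑ a f + ∑[ i < b ] f (a ℕ.+ i)
∑-split zero    b f = sym (ℤₚ.+-identityˡ _)
∑-split (suc a) b f = cong (_+_ (f 0)) (∑-split a b _) ⟨ trans ⟩ sym (ℤₚ.+-assoc (f 0) _ _)

∑-vanishing-tail : ∀ {m n} (f : ℕ → ℤ) → m ≤ n → (∀ i → m ≤ i → i < n → f i ≡ 0ℤ) → ∑ n f ≡ ∑ m f
∑-vanishing-tail {m} {n} f m≤n vanish = begin
  ∑ n f                                ≡⟨ cong (λ x → ∑ x f) (sym (ℕₚ.m+[n∸m]≡n m≤n)) ⟩
  ∑ (m ℕ.+ (n ∸ m)) f                  ≡⟨ ∑-split m (n ∸ m) f ⟩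
  ∑ m f + ∑[ i < n ∸ m ] f (m ℕ.+ i)   ≡⟨ cong (_+_ (∑ m f)) (∑-zero (n ∸ m) tail-vanishes) ⟩
  ∑ m f + 0ℤ                           ≡⟨ ℤₚ.+-identityʳ _ ⟩
  ∑ m f                                ∎
  where
  tail-vanishes : ∀ i → i < n ∸ m → f (m ℕ.+ i) ≡ 0ℤ
  tail-vanishes i i<n∸m = vanish (m ℕ.+ i) (ℕₚ.m≤m+n m i)
    (subst (m ℕ.+ i <_) (ℕₚ.m+[n∸m]≡n m≤n) (ℕₚ.+-monoʳ-< m i<n∸m))

∑-comm : ∀ n m (f : ℕ → ℕ → ℤ) → ∑[ i < n ] ∑[ j < m ] f i j ≡ ∑[ j < m ] ∑[ i < n ] f i j
∑-comm zero    m f = sym (∑-zero m (λ _ _ → refl))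
∑-comm (suc n) m f = cong (_+_ (∑ m (f 0))) (∑-comm n m _) ⟨ trans ⟩ sym (∑-distrib-+ m _ _)

∑-δ : ∀ n c (f : ℕ → ℤ) → c < n → (∀ i → i < n → i ≢ c → f i ≡ 0ℤ) → ∑ n f ≡ f c
∑-δ (suc n) zero    f c<n vanish = begin
  f 0 + ∑[ i < n ] f (suc i) ≡⟨ cong (_+_ (f 0)) (∑-zero n (λ i i<n → vanish (suc i) (s≤s i<n) λ ())) ⟩
  f 0 + 0ℤ                   ≡⟨ ℤₚ.+-identityʳ _ ⟩
  f 0                        ∎
∑-δ (suc n) (suc c) f (s≤s c<n) vanish = begin
  f 0 + ∑[ i < n ] f (suc i) ≡⟨ cong (_+ ∑[ i < n ] f (suc i)) (vanish 0 (s≤s z≤n) λ ()) ⟩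
  0ℤ + ∑[ i < n ] f (suc i)  ≡⟨ ℤₚ.+-identityˡ _ ⟩
  ∑[ i < n ] f (suc i)       ≡⟨ ∑-δ n c _ c<n (λ i i<n i≢c → vanish (suc i) (s≤s i<n) (i≢c ∘ ℕₚ.suc-injective)) ⟩
  f (suc c)                  ∎

∑-reverse : ∀ n (f : ℕ → ℤ) → ∑ n f ≡ ∑[ i < n ] f (n ∸ suc i)
∑-reverse zero    f = refl
∑-reverse (suc n) f = begin
  ∑ (suc n) f                          ≡⟨ ∑-last n f ⟩
  ∑ n f + f n                          ≡⟨ cong (_+ f n) (∑-reverse n f) ⟩
  ∑[ i < n ] f (n ∸ suc i) + f n       ≡⟨ ℤₚ.+-comm _ (f n) ⟩
  f n + ∑[ i < n ] f (n ∸ suc i)       ∎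

∑-triangle : ∀ n (g : ℕ → ℕ → ℤ) →
  ∑[ a < n ] ∑[ b < n ∸ a ] g a b ≡ ∑[ b < n ] ∑[ a < n ∸ b ] g a b
∑-triangle zero    g = refl
∑-triangle (suc n) g = begin
  ∑[ a < suc n ] ∑[ b < suc n ∸ a ] g a b
    ≡⟨ triangle-last n g ⟩
  ∑[ a < n ] ∑[ b < n ∸ a ] g a b + ∑[ a < suc n ] g a (n ∸ a)
    ≡⟨ cong₂ _+_ (∑-triangle n g) (∑-reverse (suc n) (λ a → g a (n ∸ a))) ⟩
  ∑[ b < n ] ∑[ a < n ∸ b ] g a b + ∑[ i < suc n ] g (n ∸ i) (n ∸ (n ∸ i))
    ≡⟨ cong (_+_ (∑[ b < n ] ∑[ a < n ∸ b ] g a b)) (∑-cong-< (suc n) (λ i i≤n → cong (g (n ∸ i)) (ℕₚ.m∸[m∸n]≡n (ℕₚ.≤-pred i≤n)))) ⟩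
  ∑[ b < n ] ∑[ a < n ∸ b ] g a b + ∑[ b < suc n ] g (n ∸ b) b
    ≡⟨ sym (triangle-last n (λ b a → g a b)) ⟩
  ∑[ b < suc n ] ∑[ a < suc n ∸ b ] g a b ∎
  where
  triangle-last : ∀ n (g : ℕ → ℕ → ℤ) →
    ∑[ a < suc n ] ∑[ b < suc n ∸ a ] g a b ≡ ∑[ a < n ] ∑[ b < n ∸ a ] g a b + ∑[ a < suc n ] g a (n ∸ a)
  triangle-last n g = begin
    ∑[ a < suc n ] ∑[ b < suc n ∸ a ] g a b
      ≡⟨ ∑-cong-< (suc n) (λ a a≤n → cong (λ x → ∑ x (g a)) (ℕₚ.+-∸-assoc 1 (ℕₚ.≤-pred a≤n)) ⟨ trans ⟩ ∑-last (n ∸ a) (g a)) ⟩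
    ∑[ a < suc n ] (∑[ b < n ∸ a ] g a b + g a (n ∸ a))
      ≡⟨ ∑-distrib-+ (suc n) (λ a → ∑[ b < n ∸ a ] g a b) (λ a → g a (n ∸ a)) ⟩
    ∑[ a < suc n ] ∑[ b < n ∸ a ] g a b + ∑[ a < suc n ] g a (n ∸ a)
      ≡⟨ cong (_+ ∑[ a < suc n ] g a (n ∸ a)) drop-empty-row ⟩
    ∑[ a < n ] ∑[ b < n ∸ a ] g a b + ∑[ a < suc n ] g a (n ∸ a) ∎
    where
    drop-empty-row : ∑[ a < suc n ] ∑[ b < n ∸ a ] g a b ≡ ∑[ a < n ] ∑[ b < n ∸ a ] g a b
    drop-empty-row = ∑-last n (λ a → ∑[ b < n ∸ a ] g a b)
      ⟨ trans ⟩ cong (λ x → ∑[ a < n ] ∑[ b < n ∸ a ] g a b + ∑ x (g n)) (ℕₚ.n∸n≡0 n)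
      ⟨ trans ⟩ ℤₚ.+-identityʳ _

∑-by-parts : ∀ m (D c : ℕ → ℤ) → (∀ i → i < m → D (suc i) ≡ D i + c i) →
  ∑ (suc m) D ≡ + suc m * D m - ∑[ i < m ] (+ suc i * c i)
∑-by-parts zero    D c step = ℤₚ.+-identityʳ (D 0) ⟨ trans ⟩ sym (ℤₚ.+-identityʳ _ ⟨ trans ⟩ ℤₚ.*-identityˡ (D 0))
∑-by-parts (suc m) D c step = begin
  ∑ (suc (suc m)) D                              ≡⟨ ∑-last (suc m) D ⟩
  ∑ (suc m) D + D (suc m)                        ≡⟨ cong₂ _+_ (∑-by-parts m D c (λ i i<m → step i (ℕₚ.m<n⇒m<1+n i<m)))
                                                              (step m ℕₚ.≤-refl) ⟩
  (+ suc m * D m - S) + (D m + c m)              ≡⟨ rearrange (+ suc m) (D m) (c m) S ⟩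
  (+ 1 + + suc m) * (D m + c m) - (S + + suc m * c m)
    ≡⟨ cong₂ (λ x y → (+ 1 + + suc m) * x - y) (sym (step m ℕₚ.≤-refl)) (sym (∑-last m (λ i → + suc i * c i))) ⟩
  + suc (suc m) * D (suc m) - ∑[ i < suc m ] (+ suc i * c i) ∎
  where
  S = ∑[ i < m ] (+ suc i * c i)
  rearrange : ∀ a d c s → (a * d - s) + (d + c) ≡ (+ 1 + a) * (d + c) - (s + a * c)
  rearrange = solve-∀

infixr 11 ⟦_⟧_

⟦_⟧_ : Dec P → ℤ → ℤ
⟦ yes _ ⟧ x = x
⟦ no  _ ⟧ x = 0ℤ

⟦⟧-yes : (d : Dec P) {x : ℤ} → P → ⟦ d ⟧ x ≡ x
⟦⟧-yes (yes _) p = refl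
⟦⟧-yes (no ¬p) p = ⊥-elim (¬p p)

⟦⟧-no : (d : Dec P) {x : ℤ} → ¬ P → ⟦ d ⟧ x ≡ 0ℤ
⟦⟧-no (yes p) ¬p = ⊥-elim (¬p p)
⟦⟧-no (no _)  ¬p = refl

⟦⟧-cong : (d : Dec P) {x y : ℤ} → (P → x ≡ y) → ⟦ d ⟧ x ≡ ⟦ d ⟧ y
⟦⟧-cong (yes p) eq = eq p
⟦⟧-cong (no _)  eq = refl

⟦⟧-zero : (d : Dec P) → ⟦ d ⟧ 0ℤ ≡ 0ℤ
⟦⟧-zero (yes _) = refl
⟦⟧-zero (no _)  = refl

⟦⟧-+ : (d : Dec P) (x y : ℤ) → ⟦ d ⟧ (x + y) ≡ ⟦ d ⟧ x + ⟦ d ⟧ y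
⟦⟧-+ (yes _) x y = refl
⟦⟧-+ (no _)  x y = refl

⟦⟧-*ˡ : (d : Dec P) (c x : ℤ) → ⟦ d ⟧ (c * x) ≡ c * ⟦ d ⟧ x
⟦⟧-*ˡ (yes _) c x = refl
⟦⟧-*ˡ (no _)  c x = sym (ℤₚ.*-zeroʳ c)

⟦⟧-∑ : (d : Dec P) (n : ℕ) (f : ℕ → ℤ) → ⟦ d ⟧ ∑ n f ≡ ∑[ i < n ] ⟦ d ⟧ f i
⟦⟧-∑ (yes _) n f = refl
⟦⟧-∑ (no _)  n f = sym (∑-zero n (λ _ _ → refl))

if-does≡⟦⟧ : (d : Dec P) (x : ℤ) → (if does d then x else 0ℤ) ≡ ⟦ d ⟧ x
if-does≡⟦⟧ (yes _) x = refl
if-does≡⟦⟧ (no _)  x = refl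

if-does-yes : (d : Dec P) {x y : ℤ} → P → (if does d then x else y) ≡ x
if-does-yes (yes _) p = refl
if-does-yes (no ¬p) p = ⊥-elim (¬p p)

if-does-no : (d : Dec P) {x y : ℤ} → ¬ P → (if does d then x else y) ≡ y
if-does-no (yes p) ¬p = ⊥-elim (¬p p)
if-does-no (no _)  ¬p = refl

⟦≤⟧-nest : ∀ p q w (X : ℕ → ℤ) →
  ⟦ p ≤? w ⟧ ⟦ q ≤? w ∸ p ⟧ X (w ∸ p ∸ q) ≡ ⟦ p ℕ.+ q ≤? w ⟧ X (w ∸ (p ℕ.+ q))
⟦≤⟧-nest p q w X with p ≤? w | q ≤? w ∸ p | p ℕ.+ q ≤? w
... | yes _   | yes _   | yes _  = cong X (ℕₚ.∸-+-assoc w p q)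
... | yes p≤w | yes q≤  | no ¬le = ⊥-elim (¬le (subst (_≤ w) (ℕₚ.+-comm q p) (ℕₚ.m≤o∸n⇒m+n≤o q p≤w q≤)))
... | yes _   | no ¬q≤  | yes le = ⊥-elim (¬q≤ (ℕₚ.m+n≤o⇒m≤o∸n q (subst (_≤ w) (ℕₚ.+-comm p q) le)))
... | yes _   | no _    | no _   = refl
... | no ¬p≤w | _       | yes le = ⊥-elim (¬p≤w (ℕₚ.≤-trans (ℕₚ.m≤m+n p q) le))
... | no _    | _       | no _   = refl

⟦≤⟧-comm : ∀ p q w (X : ℕ → ℤ) →
  ⟦ p ≤? w ⟧ ⟦ q ≤? w ∸ p ⟧ X (w ∸ p ∸ q) ≡ ⟦ q ≤? w ⟧ ⟦ p ≤? w ∸ q ⟧ X (w ∸ q ∸ p)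
⟦≤⟧-comm p q w X = begin
  ⟦ p ≤? w ⟧ ⟦ q ≤? w ∸ p ⟧ X (w ∸ p ∸ q)  ≡⟨ ⟦≤⟧-nest p q w X ⟩
  ⟦ p ℕ.+ q ≤? w ⟧ X (w ∸ (p ℕ.+ q))       ≡⟨ cong (λ r → ⟦ r ≤? w ⟧ X (w ∸ r)) (ℕₚ.+-comm p q) ⟩
  ⟦ q ℕ.+ p ≤? w ⟧ X (w ∸ (q ℕ.+ p))       ≡⟨ sym (⟦≤⟧-nest q p w X) ⟩
  ⟦ q ≤? w ⟧ ⟦ p ≤? w ∸ q ⟧ X (w ∸ q ∸ p)  ∎

⟦≟⟧-sym : ∀ a b (x : ℤ) → ⟦ a ≟ b ⟧ x ≡ ⟦ b ≟ a ⟧ x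
⟦≟⟧-sym a b x with a ≟ b | b ≟ a
... | yes _  | yes _  = refl
... | yes eq | no ≢   = ⊥-elim (≢ (sym eq))
... | no ≢   | yes eq = ⊥-elim (≢ (sym eq))
... | no _   | no _   = refl

⟦≟⟧-split : ∀ p x w (y : ℤ) → ⟦ p ℕ.+ x ≟ w ⟧ y ≡ ⟦ p ≤? w ⟧ ⟦ x ≟ w ∸ p ⟧ y
⟦≟⟧-split p x w y with p ℕ.+ x ≟ w | p ≤? w | x ≟ w ∸ p
... | yes _  | yes _   | yes _  = refl
... | yes eq | yes _   | no ≢   = ⊥-elim (≢ (sym (ℕₚ.m+n∸m≡n p x) ⟨ trans ⟩ cong (_∸ p) eq))
... | yes eq | no ¬p≤w | _      = ⊥-elim (¬p≤w (subst (p ≤_) eq (ℕₚ.m≤m+n p x)))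
... | no ≢   | yes p≤w | yes eq = ⊥-elim (≢ (cong (p ℕ.+_) eq ⟨ trans ⟩ ℕₚ.m+[n∸m]≡n p≤w))
... | no _   | yes _   | no _   = refl
... | no _   | no _    | _      = refl

[1+k]*[1+n]C[1+k]≡[1+n]*nCk : ∀ n k → suc k ℕ.* (suc n C suc k) ≡ suc n ℕ.* (n C k)
[1+k]*[1+n]C[1+k]≡[1+n]*nCk zero    zero    = refl
[1+k]*[1+n]C[1+k]≡[1+n]*nCk zero    (suc k) = ℕₚ.*-zeroʳ (suc (suc k))
[1+k]*[1+n]C[1+k]≡[1+n]*nCk (suc n) zero    =
  ℕₚ.*-identityˡ _ ⟨ trans ⟩ nC1≡n (suc (suc n)) ⟨ trans ⟩ sym (ℕₚ.*-identityʳ _)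
[1+k]*[1+n]C[1+k]≡[1+n]*nCk (suc n) (suc k) = begin
  suc (suc k) ℕ.* (suc (suc n) C suc (suc k))
    ≡⟨ cong (suc (suc k) ℕ.*_) (sym (nCk+nC[k+1]≡[n+1]C[k+1] (suc n) (suc k))) ⟩
  suc (suc k) ℕ.* (y ℕ.+ x)                  ≡⟨ expand k y x ⟩
  (suc k ℕ.* y ℕ.+ y) ℕ.+ suc (suc k) ℕ.* x
    ≡⟨ cong₂ (λ a b → (a ℕ.+ y) ℕ.+ b) ([1+k]*[1+n]C[1+k]≡[1+n]*nCk n k) ([1+k]*[1+n]C[1+k]≡[1+n]*nCk n (suc k)) ⟩
  (suc n ℕ.* (n C k) ℕ.+ y) ℕ.+ suc n ℕ.* (n C suc k)
    ≡⟨ regroup n (n C k) y (n C suc k) ⟩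
  suc n ℕ.* (n C k ℕ.+ n C suc k) ℕ.+ y      ≡⟨ cong (λ z → suc n ℕ.* z ℕ.+ y) (nCk+nC[k+1]≡[n+1]C[k+1] n k) ⟩
  suc n ℕ.* y ℕ.+ y                          ≡⟨ ℕₚ.+-comm (suc n ℕ.* y) y ⟩
  suc (suc n) ℕ.* y                          ∎
  where
  x = suc n C suc (suc k)
  y = suc n C suc k
  expand : ∀ k y x → suc (suc k) ℕ.* (y ℕ.+ x) ≡ (suc k ℕ.* y ℕ.+ y) ℕ.+ suc (suc k) ℕ.* x
  expand = ℕ-solve-∀
  regroup : ∀ n p y q → (suc n ℕ.* p ℕ.+ y) ℕ.+ suc n ℕ.* q ≡ suc n ℕ.* (p ℕ.+ q) ℕ.+ y
  regroup = ℕ-solve-∀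

[1+a+s]*[a+s]Ca≡[1+a]*[1+a+s]C[1+a] : ∀ a s → (suc a ℕ.+ s) ℕ.* ((a ℕ.+ s) C a) ≡ suc a ℕ.* ((suc a ℕ.+ s) C suc a)
[1+a+s]*[a+s]Ca≡[1+a]*[1+a+s]C[1+a] a s = sym ([1+k]*[1+n]C[1+k]≡[1+n]*nCk (a ℕ.+ s) a)

[a+1+s]*[a+s]Ca≡[1+s]*[a+1+s]Ca : ∀ a s → (a ℕ.+ suc s) ℕ.* ((a ℕ.+ s) C a) ≡ suc s ℕ.* ((a ℕ.+ suc s) C a)
[a+1+s]*[a+s]Ca≡[1+s]*[a+1+s]Ca a s = begin
  (a ℕ.+ suc s) ℕ.* ((a ℕ.+ s) C a)   ≡⟨ cong₂ ℕ._*_ (ℕₚ.+-suc a s) (complement a s) ⟩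
  suc (a ℕ.+ s) ℕ.* ((a ℕ.+ s) C s)   ≡⟨ sym ([1+k]*[1+n]C[1+k]≡[1+n]*nCk (a ℕ.+ s) s) ⟩
  suc s ℕ.* (suc (a ℕ.+ s) C suc s)   ≡⟨ cong (λ n → suc s ℕ.* (n C suc s)) (sym (ℕₚ.+-suc a s)) ⟩
  suc s ℕ.* ((a ℕ.+ suc s) C suc s)   ≡⟨ cong (suc s ℕ.*_) (sym (complement a (suc s))) ⟩
  suc s ℕ.* ((a ℕ.+ suc s) C a)       ∎
  where
  complement : ∀ a s → (a ℕ.+ s) C a ≡ (a ℕ.+ s) C s
  complement a s = nCk≡nC[n∸k] (ℕₚ.m≤m+n a s) ⟨ trans ⟩ cong ((a ℕ.+ s) C_) (ℕₚ.m+n∸m≡n a s)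

-- Multinomial coefficients and sums over predecessors of a composition

multinomialℤ : Vec ℕ k → ℤ
multinomialℤ α = + multinomial α

multinomialℤ-∷ : ∀ a (α : Vec ℕ k) → multinomialℤ (a ∷ α) ≡ + ((a ℕ.+ size α) C a) * multinomialℤ α
multinomialℤ-∷ a α = ℤₚ.pos-* ((a ℕ.+ size α) C a) (multinomial α)

multinomialℤ-absorb : ∀ a (α : Vec ℕ k) →
  + (suc a ℕ.+ size α) * multinomialℤ (a ∷ α) ≡ + suc a * multinomialℤ (suc a ∷ α)
multinomialℤ-absorb a α = begin
  + (suc a ℕ.+ s) * multinomialℤ (a ∷ α)                    ≡⟨ cong (+ (suc a ℕ.+ s) *_) (multinomialℤ-∷ a α) ⟩
  + (suc a ℕ.+ s) * (+ ((a ℕ.+ s) C a) * multinomialℤ α)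
    ≡⟨ sym (ℤₚ.*-assoc (+ (suc a ℕ.+ s)) (+ ((a ℕ.+ s) C a)) (multinomialℤ α)) ⟩
  (+ (suc a ℕ.+ s) * + ((a ℕ.+ s) C a)) * multinomialℤ α     ≡⟨ cong (_* multinomialℤ α) binomial ⟩
  (+ suc a * + ((suc a ℕ.+ s) C suc a)) * multinomialℤ α
    ≡⟨ ℤₚ.*-assoc (+ suc a) (+ ((suc a ℕ.+ s) C suc a)) (multinomialℤ α) ⟩
  + suc a * (+ ((suc a ℕ.+ s) C suc a) * multinomialℤ α)     ≡⟨ cong (+ suc a *_) (sym (multinomialℤ-∷ (suc a) α)) ⟩
  + suc a * multinomialℤ (suc a ∷ α)                        ∎
  where
  s = size α
  binomial : + (suc a ℕ.+ s) * + ((a ℕ.+ s) C a) ≡ + suc a * + ((suc a ℕ.+ s) C suc a)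
  binomial = sym (ℤₚ.pos-* (suc a ℕ.+ s) _) ⟨ trans ⟩ cong +_ ([1+a+s]*[a+s]Ca≡[1+a]*[1+a+s]C[1+a] a s)
             ⟨ trans ⟩ ℤₚ.pos-* (suc a) _

atPred : ℕ → (ℕ → ℤ) → ℤ
atPred zero    g = 0ℤ
atPred (suc a) g = g a

-- ∑pred j F α = Σᵢ F (j + i) (α − eᵢ), the sum running over the positions i with αᵢ > 0.
∑pred : ℕ → (ℕ → Vec ℕ k → ℤ) → Vec ℕ k → ℤ
∑pred j F []      = 0ℤ
∑pred j F (a ∷ α) = atPred a (λ a′ → F j (a′ ∷ α)) + ∑pred (suc j) (λ i β → F i (a ∷ β)) α

weightWith : ℕ → (ℕ → ℤ) → Vec ℕ k → ℤ
weightWith j c []      = 0ℤ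
weightWith j c (a ∷ α) = c j * + a + weightWith (suc j) c α

weight≡weightWith : ∀ j (α : Vec ℕ k) → + weightFrom j α ≡ weightWith j +_ α
weight≡weightWith j []      = refl
weight≡weightWith j (a ∷ α) =
  ℤₚ.pos-+ (j ℕ.* a) _ ⟨ trans ⟩ cong₂ _+_ (ℤₚ.pos-* j a) (weight≡weightWith (suc j) α)

size≡weightWith : ∀ j (α : Vec ℕ k) → + size α ≡ weightWith j (λ _ → + 1) α
size≡weightWith j []      = refl
size≡weightWith j (a ∷ α) =
  ℤₚ.pos-+ a _ ⟨ trans ⟩ cong₂ _+_ (sym (ℤₚ.*-identityˡ (+ a))) (size≡weightWith (suc j) α)

∑pred-cong : ∀ j {F G : ℕ → Vec ℕ k → ℤ} → (∀ i β → F i β ≡ G i β) → ∀ α → ∑pred j F α ≡ ∑pred j G α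
∑pred-cong j eq []          = refl
∑pred-cong j eq (zero ∷ α)  = cong (_+_ 0ℤ) (∑pred-cong (suc j) (λ i β → eq i (zero ∷ β)) α)
∑pred-cong j eq (suc a ∷ α) = cong₂ _+_ (eq j (a ∷ α)) (∑pred-cong (suc j) (λ i β → eq i (suc a ∷ β)) α)

∑pred-*ʳ : ∀ j (F : ℕ → Vec ℕ k → ℤ) c α → ∑pred j (λ i β → F i β * c) α ≡ ∑pred j F α * c
∑pred-*ʳ j F c []      = sym (ℤₚ.*-zeroˡ c)
∑pred-*ʳ j F c (a ∷ α) =
  cong₂ _+_ (head a) (∑pred-*ʳ (suc j) (λ i β → F i (a ∷ β)) c α)
  ⟨ trans ⟩ sym (ℤₚ.*-distribʳ-+ c (atPred a (λ a′ → F j (a′ ∷ α))) _)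
  where
  head : ∀ a → atPred a (λ a′ → F j (a′ ∷ α) * c) ≡ atPred a (λ a′ → F j (a′ ∷ α)) * c
  head zero    = sym (ℤₚ.*-zeroˡ c)
  head (suc a) = refl

∑pred-size≡0 : ∀ j (F : ℕ → Vec ℕ k → ℤ) α → size α ≡ 0 → ∑pred j F α ≡ 0ℤ
∑pred-size≡0 j F []      _  = refl
∑pred-size≡0 j F (a ∷ α) eq with refl ← ℕₚ.m+n≡0⇒m≡0 a eq =
  ℤₚ.+-identityˡ _ ⟨ trans ⟩ ∑pred-size≡0 (suc j) (λ i β → F i (0 ∷ β)) α (ℕₚ.m+n≡0⇒n≡0 a eq)

-- Every predecessor of α has size |α| − 1, so a factor depending only on the size comes out.
∑pred-factor : ∀ j (h : ℕ → ℤ) (F : ℕ → Vec ℕ k → ℤ) α →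
  ∑pred j (λ i β → h (size β) * F i β) α ≡ h (ℕ.pred (size α)) * ∑pred j F α
∑pred-factor j h F []      = sym (ℤₚ.*-zeroʳ (h 0))
∑pred-factor j h F (a ∷ α) =
  cong₂ _+_ (head a) (∑pred-factor (suc j) (λ x → h (a ℕ.+ x)) (λ i β → F i (a ∷ β)) α ⟨ trans ⟩ tail (size α) refl)
  ⟨ trans ⟩ sym (ℤₚ.*-distribˡ-+ (h (ℕ.pred (a ℕ.+ size α))) _ _)
  where
  D = ∑pred (suc j) (λ i β → F i (a ∷ β)) α
  head : ∀ a → atPred a (λ a′ → h (a′ ℕ.+ size α) * F j (a′ ∷ α))
             ≡ h (ℕ.pred (a ℕ.+ size α)) * atPred a (λ a′ → F j (a′ ∷ α))
  head zero    = sym (ℤₚ.*-zeroʳ (h (ℕ.pred (size α))))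
  head (suc a) = refl
  tail : ∀ s → size α ≡ s → h (a ℕ.+ ℕ.pred s) * D ≡ h (ℕ.pred (a ℕ.+ s)) * D
  tail zero    eq rewrite ∑pred-size≡0 (suc j) (λ i β → F i (a ∷ β)) α eq =
    ℤₚ.*-zeroʳ (h (a ℕ.+ 0)) ⟨ trans ⟩ sym (ℤₚ.*-zeroʳ (h (ℕ.pred (a ℕ.+ 0))))
  tail (suc s) eq = cong (λ x → h x * D) (sym (cong ℕ.pred (ℕₚ.+-suc a s)))

∑pred-monomial : ∀ {l} j (t : Vec ℤ l) (X : ℕ → Vec ℕ k → ℤ) α →
  ∑pred j (λ i β → X i β * (coef t i * monomialFrom j t β)) α ≡ monomialFrom j t α * ∑pred j X α
∑pred-monomial j t X []      = sym (ℤₚ.*-zeroʳ (+ 1))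
∑pred-monomial j t X (a ∷ α) = begin
  atPred a (λ a′ → X j (a′ ∷ α) * (T * monomialFrom j t (a′ ∷ α)))
    + ∑pred (suc j) (λ i β → X i (a ∷ β) * (coef t i * (T ^ a * monomialFrom (suc j) t β))) α
    ≡⟨ cong (_+_ (atPred a (λ a′ → X j (a′ ∷ α) * (T * monomialFrom j t (a′ ∷ α))))) tail ⟩
  atPred a (λ a′ → X j (a′ ∷ α) * (T * monomialFrom j t (a′ ∷ α))) + m * (D * T ^ a)
    ≡⟨ combine a ⟩
  (T ^ a * m) * (atPred a (λ a′ → X j (a′ ∷ α)) + D) ∎
  where
  T = coef t j
  m = monomialFrom (suc j) t α
  D = ∑pred (suc j) (λ i β → X i (a ∷ β)) α
  tail : ∑pred (suc j) (λ i β → X i (a ∷ β) * (coef t i * (T ^ a * monomialFrom (suc j) t β))) α ≡ m * (D * T ^ a)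
  tail = begin
    ∑pred (suc j) (λ i β → X i (a ∷ β) * (coef t i * (T ^ a * monomialFrom (suc j) t β))) α
      ≡⟨ ∑pred-cong (suc j) (λ i β → regroup (X i (a ∷ β)) (coef t i) (T ^ a) (monomialFrom (suc j) t β)) α ⟩
    ∑pred (suc j) (λ i β → (X i (a ∷ β) * T ^ a) * (coef t i * monomialFrom (suc j) t β)) α
      ≡⟨ ∑pred-monomial (suc j) t (λ i β → X i (a ∷ β) * T ^ a) α ⟩
    m * ∑pred (suc j) (λ i β → X i (a ∷ β) * T ^ a) α
      ≡⟨ cong (m *_) (∑pred-*ʳ (suc j) (λ i β → X i (a ∷ β)) (T ^ a) α) ⟩
    m * (D * T ^ a) ∎
    where
    regroup : ∀ x c p m → x * (c * (p * m)) ≡ (x * p) * (c * m)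
    regroup = solve-∀
  combine : ∀ a → atPred a (λ a′ → X j (a′ ∷ α) * (T * monomialFrom j t (a′ ∷ α))) + m * (D * T ^ a)
                ≡ (T ^ a * m) * (atPred a (λ a′ → X j (a′ ∷ α)) + D)
  combine zero    = no-head m D
    where
    no-head : ∀ m d → 0ℤ + m * (d * + 1) ≡ (+ 1 * m) * (0ℤ + d)
    no-head = solve-∀
  combine (suc a) = rearrange (X j (a ∷ α)) T (T ^ a) m D
    where
    rearrange : ∀ x t p m d → x * (t * (p * m)) + m * (d * (t * p)) ≡ ((t * p) * m) * (x + d)
    rearrange = solve-∀

∑pred-∷-multinomial : ∀ j (c : ℕ → ℤ) a (α : Vec ℕ k) →
  + size α * ∑pred j (λ i β → c i * multinomialℤ β) α ≡ weightWith j c α * multinomialℤ α →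
  + (a ℕ.+ size α) * ∑pred j (λ i β → c i * multinomialℤ (a ∷ β)) α ≡ weightWith j c α * multinomialℤ (a ∷ α)
∑pred-∷-multinomial j c a α ih = begin
  + (a ℕ.+ size α) * ∑pred j (λ i β → c i * multinomialℤ (a ∷ β)) α
    ≡⟨ cong (+ (a ℕ.+ size α) *_) (∑pred-cong j pull-binomial α ⟨ trans ⟩ ∑pred-factor j binom _ α) ⟩
  + (a ℕ.+ size α) * (binom (ℕ.pred (size α)) * D) ≡⟨ scaled (size α) refl ⟩
  W * (binom (size α) * multinomialℤ α)             ≡⟨ cong (W *_) (sym (multinomialℤ-∷ a α)) ⟩
  W * multinomialℤ (a ∷ α)                           ∎
  where
  D = ∑pred j (λ i β → c i * multinomialℤ β) α
  W = weightWith j c α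
  binom : ℕ → ℤ
  binom x = + ((a ℕ.+ x) C a)
  pull-binomial : ∀ i β → c i * multinomialℤ (a ∷ β) ≡ binom (size β) * (c i * multinomialℤ β)
  pull-binomial i β = cong (c i *_) (multinomialℤ-∷ a β) ⟨ trans ⟩ x*[y*z]≡y*[x*z] (c i) (binom (size β)) _
  scaled : ∀ s → size α ≡ s → + (a ℕ.+ s) * (binom (ℕ.pred s) * D) ≡ W * (binom s * multinomialℤ α)
  scaled zero eq = begin
    + (a ℕ.+ 0) * (binom 0 * D)          ≡⟨ cong (λ d → + (a ℕ.+ 0) * (binom 0 * d)) (∑pred-size≡0 j _ α eq) ⟩
    + (a ℕ.+ 0) * (binom 0 * 0ℤ)         ≡⟨ cong (+ (a ℕ.+ 0) *_) (ℤₚ.*-zeroʳ (binom 0)) ⟨ trans ⟩ ℤₚ.*-zeroʳ (+ (a ℕ.+ 0)) ⟩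
    0ℤ                                   ≡⟨ sym (ℤₚ.*-zeroʳ (binom 0)) ⟩
    binom 0 * 0ℤ
      ≡⟨ cong (binom 0 *_) (sym (ℤₚ.*-zeroˡ D) ⟨ trans ⟩ subst (λ s → + s * D ≡ W * multinomialℤ α) eq ih) ⟩
    binom 0 * (W * multinomialℤ α)       ≡⟨ x*[y*z]≡y*[x*z] (binom 0) W _ ⟩
    W * (binom 0 * multinomialℤ α)       ∎
  scaled (suc s) eq = begin
    + (a ℕ.+ suc s) * (binom s * D)      ≡⟨ sym (ℤₚ.*-assoc (+ (a ℕ.+ suc s)) (binom s) D) ⟩
    (+ (a ℕ.+ suc s) * binom s) * D
      ≡⟨ cong (_* D) (sym (ℤₚ.pos-* (a ℕ.+ suc s) _) ⟨ trans ⟩ cong +_ ([a+1+s]*[a+s]Ca≡[1+s]*[a+1+s]Ca a s)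
                       ⟨ trans ⟩ ℤₚ.pos-* (suc s) _) ⟩
    (+ suc s * binom (suc s)) * D        ≡⟨ [x*y]*z≡y*[x*z] (+ suc s) (binom (suc s)) D ⟩
    binom (suc s) * (+ suc s * D)        ≡⟨ cong (binom (suc s) *_) (subst (λ s → + s * D ≡ W * multinomialℤ α) eq ih) ⟩
    binom (suc s) * (W * multinomialℤ α) ≡⟨ x*[y*z]≡y*[x*z] (binom (suc s)) W _ ⟩
    W * (binom (suc s) * multinomialℤ α) ∎

∑pred-multinomial : ∀ j (c : ℕ → ℤ) (α : Vec ℕ k) →
  + size α * ∑pred j (λ i β → c i * multinomialℤ β) α ≡ weightWith j c α * multinomialℤ α
∑pred-multinomial j c []          = refl
∑pred-multinomial j c (zero ∷ α)  = begin
  + (0 ℕ.+ size α) * (0ℤ + ∑pred (suc j) (λ i β → c i * multinomialℤ (0 ∷ β)) α)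
    ≡⟨ cong (+ size α *_) (ℤₚ.+-identityˡ _) ⟩
  + (0 ℕ.+ size α) * ∑pred (suc j) (λ i β → c i * multinomialℤ (0 ∷ β)) α
    ≡⟨ ∑pred-∷-multinomial (suc j) c 0 α (∑pred-multinomial (suc j) c α) ⟩
  W * multinomialℤ (0 ∷ α)
    ≡⟨ cong (_* multinomialℤ (0 ∷ α)) (sym (cong (_+ W) (ℤₚ.*-zeroʳ (c j)) ⟨ trans ⟩ ℤₚ.+-identityˡ W)) ⟩
  (c j * + 0 + W) * multinomialℤ (0 ∷ α)         ∎
  where W = weightWith (suc j) c α
∑pred-multinomial j c (suc a ∷ α) = begin
  + (suc a ℕ.+ size α) * (c j * multinomialℤ (a ∷ α) + ∑pred (suc j) (λ i β → c i * multinomialℤ (suc a ∷ β)) α)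
    ≡⟨ ℤₚ.*-distribˡ-+ (+ (suc a ℕ.+ size α)) (c j * multinomialℤ (a ∷ α)) _ ⟩
  + (suc a ℕ.+ size α) * (c j * multinomialℤ (a ∷ α))
    + + (suc a ℕ.+ size α) * ∑pred (suc j) (λ i β → c i * multinomialℤ (suc a ∷ β)) α
    ≡⟨ cong₂ _+_ head (∑pred-∷-multinomial (suc j) c (suc a) α (∑pred-multinomial (suc j) c α)) ⟩
  c j * + suc a * multinomialℤ (suc a ∷ α) + W * multinomialℤ (suc a ∷ α)
    ≡⟨ sym (ℤₚ.*-distribʳ-+ (multinomialℤ (suc a ∷ α)) (c j * + suc a) W) ⟩
  (c j * + suc a + W) * multinomialℤ (suc a ∷ α) ∎
  where
  W = weightWith (suc j) c α
  head : + (suc a ℕ.+ size α) * (c j * multinomialℤ (a ∷ α)) ≡ c j * + suc a * multinomialℤ (suc a ∷ α)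
  head = x*[y*z]≡y*[x*z] (+ (suc a ℕ.+ size α)) (c j) (multinomialℤ (a ∷ α))
    ⟨ trans ⟩ cong (c j *_) (multinomialℤ-absorb a α)
    ⟨ trans ⟩ sym (ℤₚ.*-assoc (c j) (+ suc a) (multinomialℤ (suc a ∷ α)))

multinomial-recurrence : ∀ j (α : Vec ℕ k) → 1 ≤ size α → multinomialℤ α ≡ ∑pred j (λ _ β → multinomialℤ β) α
multinomial-recurrence j α 1≤|α| with size α | ∑pred-multinomial j (λ _ → + 1) α | size≡weightWith j α
... | suc s | identity | |α|≡weight = sym (ℤₚ.*-cancelˡ-≡ (+ suc s) _ _ (begin
  + suc s * ∑pred j (λ _ β → multinomialℤ β) α
    ≡⟨ cong (+ suc s *_) (∑pred-cong j (λ _ β → sym (ℤₚ.*-identityˡ (multinomialℤ β))) α) ⟩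
  + suc s * ∑pred j (λ _ β → + 1 * multinomialℤ β) α ≡⟨ identity ⟩
  weightWith j (λ _ → + 1) α * multinomialℤ α        ≡⟨ cong (_* multinomialℤ α) (sym |α|≡weight) ⟩
  + suc s * multinomialℤ α                           ∎))

-- By size*lucasCoefficient, this is the integer n/|α| · (|α| choose α) of G when weight α = n.
lucasCoefficient : Vec ℕ k → ℤ
lucasCoefficient α = ∑pred 1 (λ i β → + i * multinomialℤ β) α

size*lucasCoefficient : ∀ (α : Vec ℕ k) → + size α * lucasCoefficient α ≡ + weight α * multinomialℤ α
size*lucasCoefficient α = ∑pred-multinomial 1 +_ α ⟨ trans ⟩ cong (_* multinomialℤ α) (sym (weight≡weightWith 1 α))

-- ∑ʷ j B w f = Σ f α, over α ∈ {0,…,B}ᵏ with weightFrom j α = w.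
∑ʷ : ℕ → ℕ → ℕ → (Vec ℕ k → ℤ) → ℤ
∑ʷ {zero}  j B w f = ⟦ 0 ≟ w ⟧ f []
∑ʷ {suc k} j B w f = ∑[ a < suc B ] ⟦ j ℕ.* a ≤? w ⟧ ∑ʷ (suc j) B (w ∸ j ℕ.* a) (λ β → f (a ∷ β))

∑ʷ-cong : ∀ j B w {f g : Vec ℕ k → ℤ} → (∀ α → weightFrom j α ≡ w → f α ≡ g α) → ∑ʷ j B w f ≡ ∑ʷ j B w g
∑ʷ-cong {zero}  j B w eq = ⟦⟧-cong (0 ≟ w) (eq [])
∑ʷ-cong {suc k} j B w eq = ∑-cong (suc B) λ a → ⟦⟧-cong (j ℕ.* a ≤? w) λ ja≤w →
  ∑ʷ-cong (suc j) B (w ∸ j ℕ.* a) λ β wβ≡ → eq (a ∷ β) (cong (j ℕ.* a ℕ.+_) wβ≡ ⟨ trans ⟩ ℕₚ.m+[n∸m]≡n ja≤w)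

∑ʷ-distrib-+ : ∀ j B w (f g : Vec ℕ k → ℤ) → ∑ʷ j B w (λ α → f α + g α) ≡ ∑ʷ j B w f + ∑ʷ j B w g
∑ʷ-distrib-+ {zero}  j B w f g = ⟦⟧-+ (0 ≟ w) (f []) (g [])
∑ʷ-distrib-+ {suc k} j B w f g =
  ∑-cong (suc B) (λ a → ⟦⟧-cong (j ℕ.* a ≤? w) (λ _ → ∑ʷ-distrib-+ (suc j) B (w ∸ j ℕ.* a) (λ β → f (a ∷ β)) (λ β → g (a ∷ β)))
                         ⟨ trans ⟩ ⟦⟧-+ (j ℕ.* a ≤? w) (∑ʷ (suc j) B (w ∸ j ℕ.* a) (λ β → f (a ∷ β)))
                                                      (∑ʷ (suc j) B (w ∸ j ℕ.* a) (λ β → g (a ∷ β))))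
  ⟨ trans ⟩ ∑-distrib-+ (suc B) (λ a → ⟦ j ℕ.* a ≤? w ⟧ ∑ʷ (suc j) B (w ∸ j ℕ.* a) (λ β → f (a ∷ β)))
                                (λ a → ⟦ j ℕ.* a ≤? w ⟧ ∑ʷ (suc j) B (w ∸ j ℕ.* a) (λ β → g (a ∷ β)))

∑ʷ-*ˡ : ∀ j B w c (f : Vec ℕ k → ℤ) → ∑ʷ j B w (λ α → c * f α) ≡ c * ∑ʷ j B w f
∑ʷ-*ˡ {zero}  j B w c f = ⟦⟧-*ˡ (0 ≟ w) c (f [])
∑ʷ-*ˡ {suc k} j B w c f =
  ∑-cong (suc B) (λ a → ⟦⟧-cong (j ℕ.* a ≤? w) (λ _ → ∑ʷ-*ˡ (suc j) B (w ∸ j ℕ.* a) c (λ β → f (a ∷ β)))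
                         ⟨ trans ⟩ ⟦⟧-*ˡ (j ℕ.* a ≤? w) c _)
  ⟨ trans ⟩ ∑-*ˡ (suc B) c (λ a → ⟦ j ℕ.* a ≤? w ⟧ ∑ʷ (suc j) B (w ∸ j ℕ.* a) (λ β → f (a ∷ β)))

∑ʷ-zero : ∀ j B w → ∑ʷ {k} j B w (λ _ → 0ℤ) ≡ 0ℤ
∑ʷ-zero {k} j B w = ∑ʷ-*ˡ {k} j B w 0ℤ (λ _ → 0ℤ)

-- With weights j ≥ 1, entries beyond the weight w never contribute.
∑ʷ-bound : ∀ j B B′ w (f : Vec ℕ k → ℤ) → w ≤ B → B ≤ B′ → ∑ʷ (suc j) B′ w f ≡ ∑ʷ (suc j) B w f
∑ʷ-bound {zero}  j B B′ w f _ _ = refl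
∑ʷ-bound {suc k} j B B′ w f w≤B B≤B′ = begin
  ∑[ a < suc B′ ] ⟦ J ℕ.* a ≤? w ⟧ ∑ʷ (suc J) B′ (w ∸ J ℕ.* a) (λ β → f (a ∷ β))
    ≡⟨ ∑-cong (suc B′) (λ a → ⟦⟧-cong (J ℕ.* a ≤? w) λ _ →
         ∑ʷ-bound (suc j) B B′ (w ∸ J ℕ.* a) (λ β → f (a ∷ β)) (ℕₚ.≤-trans (ℕₚ.m∸n≤m w (J ℕ.* a)) w≤B) B≤B′) ⟩
  ∑ (suc B′) summand
    ≡⟨ ∑-vanishing-tail summand (s≤s B≤B′) (λ a B<a _ → ⟦⟧-no (J ℕ.* a ≤? w)
         (ℕₚ.<⇒≱ (ℕₚ.<-≤-trans (ℕₚ.≤-<-trans w≤B B<a) (ℕₚ.m≤n*m a J)))) ⟩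
  ∑ (suc B) summand ∎
  where
  J = suc j
  summand : ℕ → ℤ
  summand a = ⟦ J ℕ.* a ≤? w ⟧ ∑ʷ (suc J) B (w ∸ J ℕ.* a) (λ β → f (a ∷ β))

∑ʷ-weight≡0 : ∀ j B (f : Vec ℕ k → ℤ) → ∑ʷ (suc j) B 0 f ≡ f (replicate k 0)
∑ʷ-weight≡0 {zero}  j B f = refl
∑ʷ-weight≡0 {suc k} j B f = begin
  summand 0 + ∑[ a < B ] summand (suc a)
    ≡⟨ cong₂ _+_ first (∑-zero B {λ a → summand (suc a)} (λ a _ → ⟦⟧-no (J ℕ.* suc a ≤? 0) {rest (suc a)}
         (ℕₚ.<⇒≱ (ℕₚ.<-≤-trans (s≤s z≤n) (ℕₚ.m≤n*m (suc a) J))))) ⟩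
  f (replicate (suc k) 0) + 0ℤ ≡⟨ ℤₚ.+-identityʳ _ ⟩
  f (replicate (suc k) 0)      ∎
  where
  J = suc j
  rest summand : ℕ → ℤ
  rest a = ∑ʷ (suc J) B (0 ∸ J ℕ.* a) (λ β → f (a ∷ β))
  summand a = ⟦ J ℕ.* a ≤? 0 ⟧ rest a
  first : summand 0 ≡ f (replicate (suc k) 0)
  first = ⟦⟧-yes (J ℕ.* 0 ≤? 0) (ℕₚ.≤-reflexive (ℕₚ.*-zeroʳ J))
    ⟨ trans ⟩ cong (λ w → ∑ʷ (suc J) B w (λ β → f (0 ∷ β))) (ℕₚ.0∸n≡0 (J ℕ.* 0))
    ⟨ trans ⟩ ∑ʷ-weight≡0 (suc j) B (λ β → f (0 ∷ β))

∑ʷ-atPred-head : ∀ {k} j B w (G : Vec ℕ (suc k) → ℤ) → w ≤ B →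
  ∑[ a < suc B ] ⟦ suc j ℕ.* a ≤? w ⟧ ∑ʷ (suc (suc j)) B (w ∸ suc j ℕ.* a) (λ β → atPred a (λ a′ → G (a′ ∷ β)))
    ≡ ⟦ suc j ≤? w ⟧ ∑ʷ (suc j) B (w ∸ suc j) G
∑ʷ-atPred-head {k} j B w G w≤B = begin
  ⟦ J ℕ.* 0 ≤? w ⟧ ∑ʷ (suc J) B (w ∸ J ℕ.* 0) (λ (_ : Vec ℕ k) → 0ℤ) + ∑[ b < B ] shifted b
    ≡⟨ cong (_+ ∑ B shifted) (⟦⟧-cong (J ℕ.* 0 ≤? w) (λ _ → ∑ʷ-zero {k} (suc J) B (w ∸ J ℕ.* 0)) ⟨ trans ⟩ ⟦⟧-zero (J ℕ.* 0 ≤? w))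
       ⟨ trans ⟩ ℤₚ.+-identityˡ _ ⟩
  ∑ B shifted
    ≡⟨ sym (∑-vanishing-tail shifted (ℕₚ.n≤1+n B) (λ b B≤b _ → ⟦⟧-no (J ℕ.* suc b ≤? w)
         (ℕₚ.<⇒≱ (ℕₚ.<-≤-trans (ℕₚ.≤-<-trans w≤B (s≤s B≤b)) (ℕₚ.m≤n*m (suc b) J))))) ⟩
  ∑ (suc B) shifted
    ≡⟨ ∑-cong (suc B) (λ b → cong (λ r → ⟦ r ≤? w ⟧ X b (w ∸ r)) (ℕₚ.*-suc J b) ⟨ trans ⟩ sym (⟦≤⟧-nest J (J ℕ.* b) w (X b))) ⟩
  ∑[ b < suc B ] ⟦ J ≤? w ⟧ ⟦ J ℕ.* b ≤? w ∸ J ⟧ X b (w ∸ J ∸ J ℕ.* b)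
    ≡⟨ sym (⟦⟧-∑ (J ≤? w) (suc B) (λ b → ⟦ J ℕ.* b ≤? w ∸ J ⟧ X b (w ∸ J ∸ J ℕ.* b))) ⟩
  ⟦ J ≤? w ⟧ ∑ʷ J B (w ∸ J) G ∎
  where
  J = suc j
  X : ℕ → ℕ → ℤ
  X b v = ∑ʷ (suc J) B v (λ β → G (b ∷ β))
  shifted : ℕ → ℤ
  shifted b = ⟦ J ℕ.* suc b ≤? w ⟧ X b (w ∸ J ℕ.* suc b)

-- The pairs (α, i) with αᵢ > 0 correspond to the pairs (i, α − eᵢ).
∑ʷ-∑pred : ∀ j B w (F : ℕ → Vec ℕ k → ℤ) → w ≤ B →
  ∑ʷ (suc j) B w (∑pred (suc j) F) ≡ ∑[ i < k ] ⟦ suc j ℕ.+ i ≤? w ⟧ ∑ʷ (suc j) B (w ∸ (suc j ℕ.+ i)) (F (suc j ℕ.+ i))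
∑ʷ-∑pred {zero}  j B w F w≤B = ⟦⟧-zero (0 ≟ w)
∑ʷ-∑pred {suc k} j B w F w≤B = begin
  ∑[ a < suc B ] ⟦ J ℕ.* a ≤? w ⟧ ∑ʷ (suc J) B (w ∸ J ℕ.* a) (λ β → head a β + tail a β)
    ≡⟨ ∑-cong (suc B) (λ a → ⟦⟧-cong (J ℕ.* a ≤? w) (λ _ → ∑ʷ-distrib-+ (suc J) B (w ∸ J ℕ.* a) (head a) (tail a))
         ⟨ trans ⟩ ⟦⟧-+ (J ℕ.* a ≤? w) (∑ʷ (suc J) B (w ∸ J ℕ.* a) (head a)) (∑ʷ (suc J) B (w ∸ J ℕ.* a) (tail a)))
       ⟨ trans ⟩ ∑-distrib-+ (suc B) (guarded head) (guarded tail) ⟩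
  ∑ (suc B) (guarded head) + ∑ (suc B) (guarded tail)
    ≡⟨ cong₂ _+_ (∑ʷ-atPred-head j B w (F J) w≤B) tail-part ⟩
  term J + ∑[ i < k ] term (suc J ℕ.+ i)
    ≡⟨ cong₂ _+_ (cong term (sym (ℕₚ.+-identityʳ J))) (∑-cong k (λ i → cong term (sym (ℕₚ.+-suc J i)))) ⟩
  term (J ℕ.+ 0) + ∑[ i < k ] term (J ℕ.+ suc i) ∎
  where
  J = suc j
  term : ℕ → ℤ
  term r = ⟦ r ≤? w ⟧ ∑ʷ J B (w ∸ r) (F r)
  head tail : ℕ → Vec ℕ k → ℤ
  head a β = atPred a (λ a′ → F J (a′ ∷ β))
  tail a β = ∑pred (suc J) (λ i γ → F i (a ∷ γ)) β
  guarded : (ℕ → Vec ℕ k → ℤ) → ℕ → ℤ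
  guarded h a = ⟦ J ℕ.* a ≤? w ⟧ ∑ʷ (suc J) B (w ∸ J ℕ.* a) (h a)
  inner : ℕ → ℕ → ℤ
  inner a r = ∑ʷ (suc J) B (w ∸ r ∸ J ℕ.* a) (λ γ → F r (a ∷ γ))
  tail-part : ∑ (suc B) (guarded tail) ≡ ∑[ i < k ] term (suc J ℕ.+ i)
  tail-part = begin
    ∑ (suc B) (guarded tail)
      ≡⟨ ∑-cong (suc B) (λ a → ⟦⟧-cong (J ℕ.* a ≤? w) (λ _ →
           ∑ʷ-∑pred (suc j) B (w ∸ J ℕ.* a) (λ i γ → F i (a ∷ γ)) (ℕₚ.≤-trans (ℕₚ.m∸n≤m w (J ℕ.* a)) w≤B))
           ⟨ trans ⟩ ⟦⟧-∑ (J ℕ.* a ≤? w) k (removed a)) ⟩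
    ∑[ a < suc B ] ∑[ i < k ] ⟦ J ℕ.* a ≤? w ⟧ removed a i
      ≡⟨ ∑-comm (suc B) k (λ a i → ⟦ J ℕ.* a ≤? w ⟧ removed a i) ⟩
    ∑[ i < k ] ∑[ a < suc B ] ⟦ J ℕ.* a ≤? w ⟧ removed a i
      ≡⟨ ∑-cong k (λ i → ∑-cong (suc B) (λ a → ⟦≤⟧-comm (J ℕ.* a) (suc J ℕ.+ i) w
           (λ v → ∑ʷ (suc J) B v (λ γ → F (suc J ℕ.+ i) (a ∷ γ))))) ⟩
    ∑[ i < k ] ∑[ a < suc B ] ⟦ suc J ℕ.+ i ≤? w ⟧ ⟦ J ℕ.* a ≤? w ∸ (suc J ℕ.+ i) ⟧ inner a (suc J ℕ.+ i)
      ≡⟨ ∑-cong k (λ i → sym (⟦⟧-∑ (suc J ℕ.+ i ≤? w) (suc B) (λ a → ⟦ J ℕ.* a ≤? w ∸ (suc J ℕ.+ i) ⟧ inner a (suc J ℕ.+ i)))) ⟩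
    ∑[ i < k ] term (suc J ℕ.+ i) ∎
    where
    removed : ℕ → ℕ → ℤ
    removed a i = ⟦ suc J ℕ.+ i ≤? w ∸ J ℕ.* a ⟧ ∑ʷ (suc J) B (w ∸ J ℕ.* a ∸ (suc J ℕ.+ i)) (λ γ → F (suc J ℕ.+ i) (a ∷ γ))

-- Newton's identities

NewtonSequence : (ℕ → ℤ) → (ℕ → ℤ) → Set
NewtonSequence t x = ∀ n → x (suc n) ≡ ∑[ i < n ] (t (suc i) * x (n ∸ i)) + + suc n * t (suc n)

newton-unique : ∀ {t x y} → NewtonSequence t x → NewtonSequence t y → ∀ n → x (suc n) ≡ y (suc n)
newton-unique {t} {x} {y} x-newton y-newton = <-rec (λ n → x (suc n) ≡ y (suc n)) step
  where
  step : ∀ n → (∀ {m} → m < n → x (suc m) ≡ y (suc m)) → x (suc n) ≡ y (suc n)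
  step n ih = x-newton n ⟨ trans ⟩ cong (_+ + suc n * t (suc n)) (∑-cong-< n agree) ⟨ trans ⟩ sym (y-newton n)
    where
    agree : ∀ i → i < n → t (suc i) * x (n ∸ i) ≡ t (suc i) * y (n ∸ i)
    agree i i<n = cong (t (suc i) *_) (subst (λ m → x m ≡ y m) (sym (ℕₚ.+-∸-assoc 1 i<n))
                                        (ih (ℕₚ.∸-monoʳ-< {n} {suc i} {0} (s≤s z≤n) i<n)))

-- For P the coefficients of 1 / (1 − τ), τ = Σᵢ tᵢ xⁱ, newtonSums are those of L = x τ′ P;
-- since P = 1 + τ P, L = τ L + x τ′, which are Newton's identities.
module NewtonFromReciprocal (t P : ℕ → ℤ) (P-zero : P 0 ≡ + 1)
  (P-suc : ∀ w → P (suc w) ≡ ∑[ i < suc w ] (t (suc i) * P (w ∸ i))) where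

  newtonSums : ℕ → ℤ
  newtonSums n = ∑[ i < n ] (+ suc i * t (suc i) * P (n ∸ suc i))

  newtonSums-newton : NewtonSequence t newtonSums
  newtonSums-newton n = begin
    newtonSums (suc n)                                                ≡⟨ ∑-last n _ ⟩
    ∑[ j < n ] (+ suc j * t (suc j) * P (n ∸ j)) + + suc n * t (suc n) * P (n ∸ n)
      ≡⟨ cong₂ _+_ (sym convolve) last-term ⟩
    ∑[ i < n ] (t (suc i) * newtonSums (n ∸ i)) + + suc n * t (suc n) ∎
    where
    last-term : + suc n * t (suc n) * P (n ∸ n) ≡ + suc n * t (suc n)
    last-term = cong (λ m → + suc n * t (suc n) * P m) (ℕₚ.n∸n≡0 n)
      ⟨ trans ⟩ cong (+ suc n * t (suc n) *_) P-zero ⟨ trans ⟩ ℤₚ.*-identityʳ _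
    reorder : ∀ i j → n ∸ i ∸ suc j ≡ n ∸ j ∸ suc i
    reorder i j = ℕₚ.∸-+-assoc n i (suc j) ⟨ trans ⟩ cong (n ∸_) (ℕₚ.+-suc i j ⟨ trans ⟩ cong suc (ℕₚ.+-comm i j))
      ⟨ trans ⟩ sym (ℕₚ.∸-+-assoc n j (suc i) ⟨ trans ⟩ cong (n ∸_) (ℕₚ.+-suc j i))
    P-at : ∀ j → j < n → ∑[ i < n ∸ j ] (t (suc i) * P (n ∸ j ∸ suc i)) ≡ P (n ∸ j)
    P-at j j<n with n ∸ j in eq
    ... | zero  = ⊥-elim (ℕₚ.m>n⇒m∸n≢0 j<n eq)
    ... | suc w = sym (P-suc w)
    convolve : ∑[ i < n ] (t (suc i) * newtonSums (n ∸ i)) ≡ ∑[ j < n ] (+ suc j * t (suc j) * P (n ∸ j))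
    convolve = begin
      ∑[ i < n ] (t (suc i) * newtonSums (n ∸ i))
        ≡⟨ ∑-cong n (λ i → sym (∑-*ˡ (n ∸ i) (t (suc i)) _)) ⟩
      ∑[ i < n ] ∑[ j < n ∸ i ] (t (suc i) * (+ suc j * t (suc j) * P (n ∸ i ∸ suc j)))
        ≡⟨ ∑-triangle n (λ i j → t (suc i) * (+ suc j * t (suc j) * P (n ∸ i ∸ suc j))) ⟩
      ∑[ j < n ] ∑[ i < n ∸ j ] (t (suc i) * (+ suc j * t (suc j) * P (n ∸ i ∸ suc j)))
        ≡⟨ ∑-cong n (λ j → ∑-cong (n ∸ j) (λ i → x*[y*z]≡y*[x*z] (t (suc i)) (+ suc j * t (suc j)) _
             ⟨ trans ⟩ cong (λ m → + suc j * t (suc j) * (t (suc i) * P m)) (reorder i j))) ⟩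
      ∑[ j < n ] ∑[ i < n ∸ j ] (+ suc j * t (suc j) * (t (suc i) * P (n ∸ j ∸ suc i)))
        ≡⟨ ∑-cong-< n (λ j j<n → ∑-*ˡ (n ∸ j) (+ suc j * t (suc j)) _ ⟨ trans ⟩ cong (+ suc j * t (suc j) *_) (P-at j j<n)) ⟩
      ∑[ j < n ] (+ suc j * t (suc j) * P (n ∸ j)) ∎

coef-beyond : ∀ {k} (t : Vec ℤ k) l → k < l → coef t l ≡ 0ℤ
coef-beyond []           l             _         = refl
coef-beyond (x ∷ [])     (suc zero)    (s≤s ())
coef-beyond (x ∷ y ∷ xs) (suc zero)    (s≤s ())
coef-beyond (x ∷ xs)     (suc (suc j)) (s≤s k<l) = coef-beyond xs (suc j) k<l

weightFrom-size≡0 : ∀ j (α : Vec ℕ k) → size α ≡ 0 → weightFrom j α ≡ 0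
weightFrom-size≡0 j []      eq = refl
weightFrom-size≡0 j (a ∷ α) eq with refl ← ℕₚ.m+n≡0⇒m≡0 a eq =
  cong (ℕ._+ weightFrom (suc j) α) (ℕₚ.*-zeroʳ j) ⟨ trans ⟩ weightFrom-size≡0 (suc j) α (ℕₚ.m+n≡0⇒n≡0 a eq)

positive-weight⇒positive-size : ∀ (α : Vec ℕ k) {w} → weight α ≡ suc w → 1 ≤ size α
positive-weight⇒positive-size α eq with size α in |α|≡
... | zero  = ⊥-elim (ℕₚ.0≢1+n (sym (weightFrom-size≡0 1 α |α|≡) ⟨ trans ⟩ eq))
... | suc _ = s≤s z≤n

multinomial-zeros : ∀ k → multinomial (replicate k 0) ≡ 1
multinomial-zeros zero    = refl
multinomial-zeros (suc k) = ℕₚ.*-identityˡ _ ⟨ trans ⟩ multinomial-zeros k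

monomial-zeros : ∀ {l} (t : Vec ℤ l) j k → monomialFrom j t (replicate k 0) ≡ + 1
monomial-zeros t j zero    = refl
monomial-zeros t j (suc k) = ℤₚ.*-identityˡ _ ⟨ trans ⟩ monomial-zeros t (suc j) k

∑-⟦1+i≤w⟧ : ∀ k w (h : ℕ → ℤ) → (∀ i → k ≤ i → h i ≡ 0ℤ) → ∑[ i < k ] ⟦ suc i ≤? w ⟧ h i ≡ ∑ w h
∑-⟦1+i≤w⟧ k w h vanish = begin
  ∑ k guarded          ≡⟨ sym (∑-vanishing-tail guarded (ℕₚ.m≤m+n k w) (λ i k≤i _ →
                              ⟦⟧-cong (suc i ≤? w) (λ _ → vanish i k≤i) ⟨ trans ⟩ ⟦⟧-zero (suc i ≤? w))) ⟩
  ∑ (k ℕ.+ w) guarded  ≡⟨ ∑-vanishing-tail guarded (ℕₚ.m≤n+m w k) (λ i w≤i _ → ⟦⟧-no (suc i ≤? w) (ℕₚ.<⇒≱ (s≤s w≤i))) ⟩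
  ∑ w guarded          ≡⟨ ∑-cong-< w (λ i i<w → ⟦⟧-yes (suc i ≤? w) i<w) ⟩
  ∑ w h                ∎
  where
  guarded : ℕ → ℤ
  guarded i = ⟦ suc i ≤? w ⟧ h i

module Lucas {m} (t : Vec ℤ (suc m)) where

  T : ℕ → ℤ
  T = coef t

  monomial : Vec ℕ (suc m) → ℤ
  monomial = monomialFrom 1 t

  -- The coefficients of 1 / (1 − Σᵢ tᵢ xⁱ).
  reciprocal : ℕ → ℤ
  reciprocal w = ∑ʷ 1 w w (λ α → multinomialℤ α * monomial α)

  lucas : ℕ → ℤ
  lucas n = ∑ʷ 1 n n (λ α → lucasCoefficient α * monomial α)

  reciprocal-zero : reciprocal 0 ≡ + 1
  reciprocal-zero = ∑ʷ-weight≡0 0 0 (λ α → multinomialℤ α * monomial α)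
    ⟨ trans ⟩ cong₂ _*_ (cong +_ (multinomial-zeros (suc m))) (monomial-zeros t 1 (suc m))

  ∑ʷ-∑pred-monomial : ∀ (c : ℕ → ℤ) W →
    ∑ʷ 1 W W (λ α → monomial α * ∑pred 1 (λ i β → c i * multinomialℤ β) α)
      ≡ ∑[ i < W ] (c (suc i) * T (suc i) * reciprocal (W ∸ suc i))
  ∑ʷ-∑pred-monomial c W = begin
    ∑ʷ 1 W W (λ α → monomial α * ∑pred 1 (λ i β → c i * multinomialℤ β) α)
      ≡⟨ ∑ʷ-cong {suc m} 1 W W (λ α _ → sym (∑pred-monomial 1 t (λ i β → c i * multinomialℤ β) α)) ⟩
    ∑ʷ 1 W W (∑pred 1 (λ i β → (c i * multinomialℤ β) * (T i * monomial β)))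
      ≡⟨ ∑ʷ-∑pred {suc m} 0 W W (λ i β → (c i * multinomialℤ β) * (T i * monomial β)) ℕₚ.≤-refl ⟩
    ∑[ i < suc m ] ⟦ suc i ≤? W ⟧ ∑ʷ 1 W (W ∸ suc i) (λ β → (c (suc i) * multinomialℤ β) * (T (suc i) * monomial β))
      ≡⟨ ∑-cong (suc m) (λ i → ⟦⟧-cong (suc i ≤? W) (λ _ → factor-out i)) ⟩
    ∑[ i < suc m ] ⟦ suc i ≤? W ⟧ (c (suc i) * T (suc i) * reciprocal (W ∸ suc i))
      ≡⟨ ∑-⟦1+i≤w⟧ (suc m) W (λ i → c (suc i) * T (suc i) * reciprocal (W ∸ suc i)) vanish ⟩
    ∑[ i < W ] (c (suc i) * T (suc i) * reciprocal (W ∸ suc i)) ∎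
    where
    vanish : ∀ i → suc m ≤ i → c (suc i) * T (suc i) * reciprocal (W ∸ suc i) ≡ 0ℤ
    vanish i k≤i rewrite coef-beyond t (suc i) (s≤s k≤i) | ℤₚ.*-zeroʳ (c (suc i)) = ℤₚ.*-zeroˡ (reciprocal (W ∸ suc i))
    factor-out : ∀ i → ∑ʷ 1 W (W ∸ suc i) (λ β → (c (suc i) * multinomialℤ β) * (T (suc i) * monomial β))
                       ≡ c (suc i) * T (suc i) * reciprocal (W ∸ suc i)
    factor-out i = begin
      ∑ʷ 1 W (W ∸ suc i) (λ β → (c (suc i) * multinomialℤ β) * (T (suc i) * monomial β))
        ≡⟨ ∑ʷ-cong {suc m} 1 W (W ∸ suc i) (λ β _ → interchange′ (c (suc i)) (multinomialℤ β) (T (suc i)) (monomial β)) ⟩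
      ∑ʷ 1 W (W ∸ suc i) (λ β → c (suc i) * T (suc i) * (multinomialℤ β * monomial β))
        ≡⟨ ∑ʷ-*ˡ {suc m} 1 W (W ∸ suc i) (c (suc i) * T (suc i)) (λ β → multinomialℤ β * monomial β) ⟩
      c (suc i) * T (suc i) * ∑ʷ 1 W (W ∸ suc i) (λ β → multinomialℤ β * monomial β)
        ≡⟨ cong (c (suc i) * T (suc i) *_) (∑ʷ-bound {suc m} 0 (W ∸ suc i) W (W ∸ suc i)
             (λ β → multinomialℤ β * monomial β) ℕₚ.≤-refl (ℕₚ.m∸n≤m W (suc i))) ⟩
      c (suc i) * T (suc i) * reciprocal (W ∸ suc i) ∎
      where
      interchange′ : ∀ a b c d → (a * b) * (c * d) ≡ (a * c) * (b * d)
      interchange′ = solve-∀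

  reciprocal-suc : ∀ w → reciprocal (suc w) ≡ ∑[ i < suc w ] (T (suc i) * reciprocal (w ∸ i))
  reciprocal-suc w = begin
    reciprocal (suc w)
      ≡⟨ ∑ʷ-cong {suc m} 1 (suc w) (suc w) (λ α wα≡ →
           cong (_* monomial α) (multinomial-recurrence 1 α (positive-weight⇒positive-size α wα≡))
           ⟨ trans ⟩ ℤₚ.*-comm _ (monomial α)
           ⟨ trans ⟩ cong (monomial α *_) (∑pred-cong 1 (λ _ β → sym (ℤₚ.*-identityˡ _)) α)) ⟩
    ∑ʷ 1 (suc w) (suc w) (λ α → monomial α * ∑pred 1 (λ _ β → + 1 * multinomialℤ β) α)
      ≡⟨ ∑ʷ-∑pred-monomial (λ _ → + 1) (suc w) ⟩
    ∑[ i < suc w ] (+ 1 * T (suc i) * reciprocal (w ∸ i))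
      ≡⟨ ∑-cong (suc w) (λ i → cong (_* reciprocal (w ∸ i)) (ℤₚ.*-identityˡ (T (suc i)))) ⟩
    ∑[ i < suc w ] (T (suc i) * reciprocal (w ∸ i)) ∎

  open NewtonFromReciprocal T reciprocal reciprocal-zero reciprocal-suc

  lucas≡newtonSums : ∀ n → lucas n ≡ newtonSums n
  lucas≡newtonSums n =
    ∑ʷ-cong {suc m} 1 n n (λ α _ → ℤₚ.*-comm (lucasCoefficient α) (monomial α)) ⟨ trans ⟩ ∑ʷ-∑pred-monomial +_ n

  lucas-newton : NewtonSequence T lucas
  lucas-newton n = lucas≡newtonSums (suc n)
    ⟨ trans ⟩ newtonSums-newton n
    ⟨ trans ⟩ cong (_+ + suc n * T (suc n)) (∑-cong n (λ i → cong (T (suc i) *_) (sym (lucas≡newtonSums (n ∸ i)))))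

-- The rational sum defining G is the integer lucas

ι : ℤ → ℚ
ι x = x / 1

toℚᵘ-ι : ∀ x d → toℚᵘ (x / suc d) ℚᵘ.≃ ℚᵘ.mkℚᵘ x d
toℚᵘ-ι x d = ℚₚ.toℚᵘ-fromℚᵘ (ℚᵘ.mkℚᵘ x d)

ι-+ : ∀ x y → ι (x + y) ≡ ι x ℚ.+ ι y
ι-+ x y = ℚₚ.toℚᵘ-injective (ℚᵘₚ.≃-trans (toℚᵘ-ι (x + y) 0) (ℚᵘₚ.≃-trans (ℚᵘ.*≡* (scale x y))
  (ℚᵘₚ.≃-sym (ℚᵘₚ.≃-trans (ℚₚ.toℚᵘ-homo-+ (ι x) (ι y)) (ℚᵘₚ.+-cong (toℚᵘ-ι x 0) (toℚᵘ-ι y 0))))))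
  where
  scale : ∀ x y → (x + y) * + 1 ≡ (x * + 1 + y * + 1) * + 1
  scale = solve-∀

ratio-integral : ∀ n s (M u q : ℤ) → + n * M ≡ + suc s * q → (+ n / suc s) ℚ.* ι M ℚ.* ι u ≡ ι (q * u)
ratio-integral n s M u q n*M≡[1+s]*q = ℚₚ.toℚᵘ-injective (ℚᵘₚ.≃-trans (ℚₚ.toℚᵘ-homo-* ((+ n / suc s) ℚ.* ι M) (ι u))
  (ℚᵘₚ.≃-trans (ℚᵘₚ.*-cong (ℚᵘₚ.≃-trans (ℚₚ.toℚᵘ-homo-* (+ n / suc s) (ι M)) (ℚᵘₚ.*-cong (toℚᵘ-ι (+ n) s) (toℚᵘ-ι M 0)))
                          (toℚᵘ-ι u 0))
  (ℚᵘₚ.≃-trans (ℚᵘ.*≡* cross-multiplied) (ℚᵘₚ.≃-sym (toℚᵘ-ι (q * u) 0)))))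
  where
  cross-multiplied : ((+ n * M) * u) * + 1 ≡ (q * u) * + (suc s ℕ.* 1 ℕ.* 1)
  cross-multiplied = ℤₚ.*-identityʳ _ ⟨ trans ⟩ cong (_* u) n*M≡[1+s]*q ⟨ trans ⟩ rotate (+ suc s) q u
    ⟨ trans ⟩ cong (λ d → (q * u) * + d) (sym (ℕₚ.*-identityʳ _ ⟨ trans ⟩ ℕₚ.*-identityʳ _))
    where
    rotate : ∀ a b c → (a * b) * c ≡ (b * c) * a
    rotate = solve-∀

∑ˡ : {A : Set} → List A → (A → ℤ) → ℤ
∑ˡ []       f = 0ℤ
∑ˡ (x ∷ xs) f = f x + ∑ˡ xs f

∑ˡ-++ : ∀ {A : Set} (xs ys : List A) f → ∑ˡ (xs ++ ys) f ≡ ∑ˡ xs f + ∑ˡ ys f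
∑ˡ-++ []       ys f = sym (ℤₚ.+-identityˡ _)
∑ˡ-++ (x ∷ xs) ys f = cong (_+_ (f x)) (∑ˡ-++ xs ys f) ⟨ trans ⟩ sym (ℤₚ.+-assoc (f x) _ _)

∑ˡ-map : ∀ {A B : Set} (g : A → B) (xs : List A) f → ∑ˡ (map g xs) f ≡ ∑ˡ xs (f ∘ g)
∑ˡ-map g []       f = refl
∑ˡ-map g (x ∷ xs) f = cong (_+_ (f (g x))) (∑ˡ-map g xs f)

∑ˡ-concatMap : ∀ {A B : Set} (g : A → List B) (xs : List A) f → ∑ˡ (concatMap g xs) f ≡ ∑ˡ xs (λ x → ∑ˡ (g x) f)
∑ˡ-concatMap g []       f = refl
∑ˡ-concatMap g (x ∷ xs) f = ∑ˡ-++ (g x) (concatMap g xs) f ⟨ trans ⟩ cong (_+_ (∑ˡ (g x) f)) (∑ˡ-concatMap g xs f)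

∑ˡ-applyUpTo : ∀ (g : ℕ → ℕ) n f → ∑ˡ (applyUpTo g n) f ≡ ∑[ i < n ] f (g i)
∑ˡ-applyUpTo g zero    f = refl
∑ˡ-applyUpTo g (suc n) f = cong (_+_ (f (g 0))) (∑ˡ-applyUpTo (g ∘ suc) n f)

∑ˡ-cong : ∀ {A : Set} (xs : List A) {f g : A → ℤ} → (∀ x → f x ≡ g x) → ∑ˡ xs f ≡ ∑ˡ xs g
∑ˡ-cong []       eq = refl
∑ˡ-cong (x ∷ xs) eq = cong₂ _+_ (eq x) (∑ˡ-cong xs eq)

∑ˡ-⟦⟧ : ∀ {A : Set} (d : Dec P) (xs : List A) f → ∑ˡ xs (λ x → ⟦ d ⟧ f x) ≡ ⟦ d ⟧ ∑ˡ xs f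
∑ˡ-⟦⟧ d []       f = sym (⟦⟧-zero d)
∑ˡ-⟦⟧ d (x ∷ xs) f = cong (_+_ (⟦ d ⟧ f x)) (∑ˡ-⟦⟧ d xs f) ⟨ trans ⟩ sym (⟦⟧-+ d (f x) _)

∑ˡ-boundedVecs : ∀ k j B w (f : Vec ℕ k → ℤ) →
  ∑ˡ (boundedVecs k B) (λ α → ⟦ weightFrom j α ≟ w ⟧ f α) ≡ ∑ʷ j B w f
∑ˡ-boundedVecs zero    j B w f = ℤₚ.+-identityʳ _
∑ˡ-boundedVecs (suc k) j B w f = begin
  ∑ˡ (concatMap (λ a → map (a ∷_) (boundedVecs k B)) (upTo (suc B))) summand
    ≡⟨ ∑ˡ-concatMap (λ a → map (a ∷_) (boundedVecs k B)) (upTo (suc B)) summand ⟩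
  ∑ˡ (upTo (suc B)) (λ a → ∑ˡ (map (a ∷_) (boundedVecs k B)) summand)
    ≡⟨ ∑ˡ-applyUpTo id (suc B) (λ a → ∑ˡ (map (a ∷_) (boundedVecs k B)) summand) ⟩
  ∑[ a < suc B ] ∑ˡ (map (a ∷_) (boundedVecs k B)) summand
    ≡⟨ ∑-cong (suc B) (λ a → ∑ˡ-map (a ∷_) (boundedVecs k B) summand ⟨ trans ⟩ first-entry a) ⟩
  ∑ʷ j B w f ∎
  where
  summand : Vec ℕ (suc k) → ℤ
  summand α = ⟦ weightFrom j α ≟ w ⟧ f α
  first-entry : ∀ a → ∑ˡ (boundedVecs k B) (λ β → summand (a ∷ β))
                        ≡ ⟦ j ℕ.* a ≤? w ⟧ ∑ʷ (suc j) B (w ∸ j ℕ.* a) (λ β → f (a ∷ β))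
  first-entry a = begin
    ∑ˡ (boundedVecs k B) (λ β → summand (a ∷ β))
      ≡⟨ ∑ˡ-cong (boundedVecs k B) (λ β → ⟦≟⟧-split (j ℕ.* a) (weightFrom (suc j) β) w (f (a ∷ β))) ⟩
    ∑ˡ (boundedVecs k B) (λ β → ⟦ j ℕ.* a ≤? w ⟧ ⟦ weightFrom (suc j) β ≟ w ∸ j ℕ.* a ⟧ f (a ∷ β))
      ≡⟨ ∑ˡ-⟦⟧ (j ℕ.* a ≤? w) (boundedVecs k B) _ ⟩
    ⟦ j ℕ.* a ≤? w ⟧ ∑ˡ (boundedVecs k B) (λ β → ⟦ weightFrom (suc j) β ≟ w ∸ j ℕ.* a ⟧ f (a ∷ β))
      ≡⟨ cong (⟦ j ℕ.* a ≤? w ⟧_) (∑ˡ-boundedVecs k (suc j) B (w ∸ j ℕ.* a) (λ β → f (a ∷ β))) ⟩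
    ⟦ j ℕ.* a ≤? w ⟧ ∑ʷ (suc j) B (w ∸ j ℕ.* a) (λ β → f (a ∷ β)) ∎

foldr-filter≡ι∑ˡ : ∀ {A : Set} {Q : A → Set} (Q? : Decidable Q) (f : A → ℚ) (h : A → ℤ) →
  (∀ x → Q x → f x ≡ ι (h x)) → ∀ xs → foldr ℚ._+_ 0ℚ (map f (filter Q? xs)) ≡ ι (∑ˡ xs (λ x → ⟦ Q? x ⟧ h x))
foldr-filter≡ι∑ˡ Q? f h eq []       = refl
foldr-filter≡ι∑ˡ Q? f h eq (x ∷ xs) with Q? x
... | yes q = cong₂ ℚ._+_ (eq x q) (foldr-filter≡ι∑ˡ Q? f h eq xs) ⟨ trans ⟩ sym (ι-+ (h x) _)
... | no _  = foldr-filter≡ι∑ˡ Q? f h eq xs ⟨ trans ⟩ cong ι (sym (ℤₚ.+-identityˡ (∑ˡ xs (λ x → ⟦ Q? x ⟧ h x))))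

G≡lucas : ∀ {m} (t : Vec ℤ (suc m)) n → G t (suc n) ≡ ι (Lucas.lucas t (suc n))
G≡lucas {m} t n =
  foldr-filter≡ι∑ˡ (λ α → weight α ≟ suc n) (lucasTerm t (suc n)) h term (boundedVecs (suc m) (suc n))
  ⟨ trans ⟩ cong ι (∑ˡ-boundedVecs (suc m) 1 (suc n) (suc n) h)
  where
  h : Vec ℕ (suc m) → ℤ
  h α = lucasCoefficient α * monomialFrom 1 t α
  term : ∀ α → weight α ≡ suc n → lucasTerm t (suc n) α ≡ ι (h α)
  term α wα≡ with size α in |α|≡ | size*lucasCoefficient α
  ... | zero  | _     = ⊥-elim (ℕₚ.<⇒≱ (positive-weight⇒positive-size α wα≡) (ℕₚ.≤-reflexive |α|≡))
  ... | suc s | scale = ratio-integral (suc n) s (multinomialℤ α) (monomialFrom 1 t α) (lucasCoefficient α)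
                          (sym (scale ⟨ trans ⟩ cong (λ w → + w * multinomialℤ α) wα≡))

at : (Fin k → ℤ) → ℕ → ℤ
at {k} v i with i <? k
... | yes i<k = v (fromℕ< i<k)
... | no  _   = 0ℤ

at-< : (v : Fin k → ℤ) {i : ℕ} (i<k : i < k) → at v i ≡ v (fromℕ< i<k)
at-< {k} v {i} i<k with i <? k
... | yes _   = refl
... | no i≮k  = ⊥-elim (i≮k i<k)

at-toℕ : (v : Fin k → ℤ) (x : Fin k) → at v (toℕ x) ≡ v x
at-toℕ v x = at-< v (Finₚ.toℕ<n x) ⟨ trans ⟩ cong v (Finₚ.fromℕ<-toℕ x (Finₚ.toℕ<n x))

entry : Matrix k → ℕ → ℕ → ℤ
entry M i j = at (λ x → at (M x) j) i

entry-< : (M : Matrix k) {i j : ℕ} (i<k : i < k) (j<k : j < k) → entry M i j ≡ M (fromℕ< i<k) (fromℕ< j<k)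
entry-< M i<k j<k = at-< (λ x → at (M x) _) i<k ⟨ trans ⟩ at-< (M (fromℕ< i<k)) j<k

Σℤ≡∑ : ∀ k (f : Fin k → ℤ) (g : ℕ → ℤ) → (∀ x → f x ≡ g (toℕ x)) → Σℤ k f ≡ ∑ k g
Σℤ≡∑ zero    f g eq = refl
Σℤ≡∑ (suc k) f g eq = cong₂ _+_ (eq Fin.zero) (Σℤ≡∑ k (f ∘ Fin.suc) (g ∘ suc) (eq ∘ Fin.suc))

entry-⊗ : (M N : Matrix k) {i j : ℕ} → i < k → j < k → entry (M ⊗ N) i j ≡ ∑[ l < k ] (entry M i l * entry N l j)
entry-⊗ {k} M N i<k j<k = entry-< (M ⊗ N) i<k j<k ⟨ trans ⟩ Σℤ≡∑ k _ _ (λ l → sym (cong₂ _*_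
  (entry-< M i<k (Finₚ.toℕ<n l) ⟨ trans ⟩ cong (M (fromℕ< i<k)) (Finₚ.fromℕ<-toℕ l (Finₚ.toℕ<n l)))
  (entry-< N (Finₚ.toℕ<n l) j<k ⟨ trans ⟩ cong (λ x → N x (fromℕ< j<k)) (Finₚ.fromℕ<-toℕ l (Finₚ.toℕ<n l)))))

entry-identity : ∀ {i j} → i < k → j < k → entry (identity {k}) i j ≡ ⟦ i ≟ j ⟧ (+ 1)
entry-identity {i = i} {j} i<k j<k = entry-< identity i<k j<k
  ⟨ trans ⟩ if-does≡⟦⟧ (toℕ (fromℕ< i<k) ≟ toℕ (fromℕ< j<k)) (+ 1)
  ⟨ trans ⟩ cong₂ (λ a b → ⟦ a ≟ b ⟧ (+ 1)) (Finₚ.toℕ-fromℕ< i<k) (Finₚ.toℕ-fromℕ< j<k)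

identity-⊗ˡ : ∀ (Y : ℕ → ℤ) {i} → i < k → ∑[ l < k ] (entry (identity {k}) i l * Y l) ≡ Y i
identity-⊗ˡ {k} Y {i} i<k = ∑-δ k i _ i<k (λ l l<k l≢i →
    cong (_* Y l) (entry-identity i<k l<k ⟨ trans ⟩ ⟦⟧-no (i ≟ l) (l≢i ∘ sym)) ⟨ trans ⟩ ℤₚ.*-zeroˡ (Y l))
  ⟨ trans ⟩ cong (_* Y i) (entry-identity i<k i<k ⟨ trans ⟩ ⟦⟧-yes (i ≟ i) refl) ⟨ trans ⟩ ℤₚ.*-identityˡ (Y i)

identity-⊗ʳ : ∀ (X : ℕ → ℤ) {j} → j < k → ∑[ l < k ] (X l * entry (identity {k}) l j) ≡ X j
identity-⊗ʳ {k} X {j} j<k = ∑-δ k j _ j<k (λ l l<k l≢j →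
    cong (X l *_) (entry-identity l<k j<k ⟨ trans ⟩ ⟦⟧-no (l ≟ j) l≢j) ⟨ trans ⟩ ℤₚ.*-zeroʳ (X l))
  ⟨ trans ⟩ cong (X j *_) (entry-identity j<k j<k ⟨ trans ⟩ ⟦⟧-yes (j ≟ j) refl) ⟨ trans ⟩ ℤₚ.*-identityʳ (X j)

-- The companion matrix

module Companion {m} (t : Vec ℤ (suc m)) where

  A : Matrix (suc m)
  A = companion t

  T : ℕ → ℤ
  T = coef t

  power : ℕ → ℕ → ℕ → ℤ
  power n = entry (A ^ᴹ n)

  d : ℕ → ℤ
  d = at (derivCoeffs t)

  companion-last-row : ∀ {j} → j < suc m → entry A m j ≡ T (suc m ∸ j)
  companion-last-row {j} j<k = begin
    entry A m j                                ≡⟨ entry-< A ℕₚ.≤-refl j<k ⟩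
    A (fromℕ< ℕₚ.≤-refl) (fromℕ< j<k)           ≡⟨ if-does-yes (toℕ (fromℕ< ℕₚ.≤-refl) ≟ m) (Finₚ.toℕ-fromℕ< ℕₚ.≤-refl) ⟩
    coef t (suc m ∸ toℕ (fromℕ< j<k))          ≡⟨ cong (λ x → T (suc m ∸ x)) (Finₚ.toℕ-fromℕ< j<k) ⟩
    T (suc m ∸ j)                              ∎

  companion-upper : ∀ {l j} → l < m → j < suc m → entry A l j ≡ ⟦ j ≟ suc l ⟧ (+ 1)
  companion-upper {l} {j} l<m j<k = begin
    entry A l j                                ≡⟨ entry-< A l<k j<k ⟩
    A (fromℕ< l<k) (fromℕ< j<k)
      ≡⟨ if-does-no (toℕ (fromℕ< l<k) ≟ m) (λ eq → ℕₚ.<⇒≢ l<m (sym (Finₚ.toℕ-fromℕ< l<k) ⟨ trans ⟩ eq)) ⟩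
    (if does (toℕ (fromℕ< j<k) ≟ suc (toℕ (fromℕ< l<k))) then + 1 else 0ℤ)
      ≡⟨ if-does≡⟦⟧ (toℕ (fromℕ< j<k) ≟ suc (toℕ (fromℕ< l<k))) (+ 1) ⟩
    ⟦ toℕ (fromℕ< j<k) ≟ suc (toℕ (fromℕ< l<k)) ⟧ (+ 1)
      ≡⟨ cong₂ (λ a b → ⟦ a ≟ suc b ⟧ (+ 1)) (Finₚ.toℕ-fromℕ< j<k) (Finₚ.toℕ-fromℕ< l<k) ⟩
    ⟦ j ≟ suc l ⟧ (+ 1)                        ∎
    where l<k = ℕₚ.m<n⇒m<1+n l<m

  -- Column j of A has a 1 in row j − 1 (if j > 0) and T (k − j) in the last row.
  ∑-column : ∀ (X : ℕ → ℤ) {j} → j < suc m → ∑[ l < suc m ] (X l * entry A l j) ≡ atPred j X + X m * T (suc m ∸ j)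
  ∑-column X {j} j<k = ∑-last m (λ l → X l * entry A l j) ⟨ trans ⟩ cong₂ _+_
    (∑-cong-< m (λ l l<m → cong (X l *_) (companion-upper l<m j<k)) ⟨ trans ⟩ superdiagonal j j<k)
    (cong (X m *_) (companion-last-row j<k))
    where
    superdiagonal : ∀ j → j < suc m → ∑[ l < m ] (X l * ⟦ j ≟ suc l ⟧ (+ 1)) ≡ atPred j X
    superdiagonal zero    _         = ∑-zero m (λ l _ → cong (X l *_) (⟦⟧-no (0 ≟ suc l) {+ 1} (λ ())) ⟨ trans ⟩ ℤₚ.*-zeroʳ (X l))
    superdiagonal (suc j) (s≤s j<m) = ∑-δ m j _ j<m (λ l _ l≢j →
        cong (X l *_) (⟦⟧-no (suc j ≟ suc l) (l≢j ∘ sym ∘ ℕₚ.suc-injective)) ⟨ trans ⟩ ℤₚ.*-zeroʳ (X l))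
      ⟨ trans ⟩ cong (X j *_) (⟦⟧-yes (suc j ≟ suc j) refl) ⟨ trans ⟩ ℤₚ.*-identityʳ (X j)

  power-suc : ∀ n {i j} → i < suc m → j < suc m → power (suc n) i j ≡ ∑[ l < suc m ] (power n i l * entry A l j)
  power-suc n = entry-⊗ (A ^ᴹ n) A

  -- Row i < m of A is the unit row eᵢ₊₁, and Aⁿ⁺¹ = A Aⁿ.
  power-suc-row : ∀ n {i j} → i < m → j < suc m → power (suc n) i j ≡ power n (suc i) j
  power-suc-row zero {i} {j} i<m j<k = begin
    power 1 i j                                        ≡⟨ power-suc 0 i<k j<k ⟩
    ∑[ l < suc m ] (power 0 i l * entry A l j)          ≡⟨ identity-⊗ˡ (λ l → entry A l j) i<k ⟩
    entry A i j                                        ≡⟨ companion-upper i<m j<k ⟩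
    ⟦ j ≟ suc i ⟧ (+ 1)                                ≡⟨ ⟦≟⟧-sym j (suc i) (+ 1) ⟩
    ⟦ suc i ≟ j ⟧ (+ 1)                                ≡⟨ sym (entry-identity (s≤s i<m) j<k) ⟩
    power 0 (suc i) j                                  ∎
    where i<k = ℕₚ.m<n⇒m<1+n i<m
  power-suc-row (suc n) {i} {j} i<m j<k = begin
    power (suc (suc n)) i j                            ≡⟨ power-suc (suc n) i<k j<k ⟩
    ∑[ l < suc m ] (power (suc n) i l * entry A l j)
      ≡⟨ ∑-cong-< (suc m) (λ l l<k → cong (_* entry A l j) (power-suc-row n i<m l<k)) ⟩
    ∑[ l < suc m ] (power n (suc i) l * entry A l j)    ≡⟨ sym (power-suc n (s≤s i<m) j<k) ⟩
    power (suc n) (suc i) j                            ∎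
    where i<k = ℕₚ.m<n⇒m<1+n i<m

  power-diagonal-suc : ∀ n {i} → i < m → power n (suc i) (suc i) ≡ power n i i + T (m ∸ i) * power n i m
  power-diagonal-suc n {i} i<m = begin
    power n (suc i) (suc i)                            ≡⟨ sym (power-suc-row n i<m (s≤s i<m)) ⟩
    power (suc n) i (suc i)                            ≡⟨ power-suc n (ℕₚ.m<n⇒m<1+n i<m) (s≤s i<m) ⟩
    ∑[ l < suc m ] (power n i l * entry A l (suc i))    ≡⟨ ∑-column (power n i) (s≤s i<m) ⟩
    power n i i + power n i m * T (m ∸ i)              ≡⟨ cong (_+_ (power n i i)) (ℤₚ.*-comm (power n i m) (T (m ∸ i))) ⟩
    power n i i + T (m ∸ i) * power n i m              ∎

  derivCoeffs-last : d m ≡ + suc m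
  derivCoeffs-last = at-< (derivCoeffs t) ℕₚ.≤-refl ⟨ trans ⟩ if-does-yes (toℕ (fromℕ< ℕₚ.≤-refl) ≟ m) (Finₚ.toℕ-fromℕ< ℕₚ.≤-refl)

  derivCoeffs-< : ∀ {i} → i < m → d i ≡ - (+ suc i * T (m ∸ i))
  derivCoeffs-< {i} i<m = at-< (derivCoeffs t) i<k
    ⟨ trans ⟩ if-does-no (toℕ (fromℕ< i<k) ≟ m) (λ eq → ℕₚ.<⇒≢ i<m (sym (Finₚ.toℕ-fromℕ< i<k) ⟨ trans ⟩ eq))
    ⟨ trans ⟩ cong (λ x → - (+ suc x * T (m ∸ x))) (Finₚ.toℕ-fromℕ< i<k)
    where i<k = ℕₚ.m<n⇒m<1+n i<m

  row : ℕ → ℕ → ℤ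
  row n j = ∑[ i < suc m ] (d i * power n i j)

  last : ℕ → ℤ
  last n = row n m

  row-last≡ : ∀ n → (derivCoeffs t ·ᴹ (A ^ᴹ n)) (fromℕ m) ≡ last n
  row-last≡ n = Σℤ≡∑ (suc m) _ (λ i → d i * power n i m) (λ x → cong₂ _*_ (sym (at-toℕ (derivCoeffs t) x))
    (sym (cong (power n (toℕ x)) (sym (Finₚ.toℕ-fromℕ m)) ⟨ trans ⟩ at-toℕ (λ y → at ((A ^ᴹ n) y) (toℕ (fromℕ m))) x
                                                             ⟨ trans ⟩ at-toℕ ((A ^ᴹ n) x) (fromℕ m))))

  trace≡∑ : ∀ n → trace (A ^ᴹ n) ≡ ∑[ i < suc m ] power n i i
  trace≡∑ n = Σℤ≡∑ (suc m) _ (λ i → power n i i) (λ x →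
    sym (at-toℕ (λ y → at ((A ^ᴹ n) y) (toℕ x)) x ⟨ trans ⟩ at-toℕ ((A ^ᴹ n) x) x))

  -- Sum by parts along the diagonal (power-diagonal-suc); the weights i + 1 that appear are the entries of d.
  ∑-diagonal≡last : ∀ n → ∑[ i < suc m ] power n i i ≡ last n
  ∑-diagonal≡last n = begin
    ∑[ i < suc m ] power n i i
      ≡⟨ ∑-by-parts m (λ i → power n i i) (λ i → T (m ∸ i) * power n i m) (λ i → power-diagonal-suc n) ⟩
    + suc m * power n m m - S                       ≡⟨ ℤₚ.+-comm (+ suc m * power n m m) (- S) ⟩
    - S + + suc m * power n m m
      ≡⟨ cong₂ _+_ (sym (∑-neg m _) ⟨ trans ⟩ ∑-cong-< m (λ i i<m → low-term i i<m))
                   (cong (_* power n m m) (sym derivCoeffs-last)) ⟩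
    ∑[ i < m ] (d i * power n i m) + d m * power n m m ≡⟨ sym (∑-last m (λ i → d i * power n i m)) ⟩
    last n ∎
    where
    S = ∑[ i < m ] (+ suc i * (T (m ∸ i) * power n i m))
    low-term : ∀ i → i < m → - (+ suc i * (T (m ∸ i) * power n i m)) ≡ d i * power n i m
    low-term i i<m = cong -_ (sym (ℤₚ.*-assoc (+ suc i) (T (m ∸ i)) (power n i m)))
      ⟨ trans ⟩ ℤₚ.neg-distribˡ-* (+ suc i * T (m ∸ i)) (power n i m)
      ⟨ trans ⟩ cong (_* power n i m) (sym (derivCoeffs-< i<m))

  row-suc : ∀ n {j} → j < suc m → row (suc n) j ≡ atPred j (row n) + last n * T (suc m ∸ j)
  row-suc n {j} j<k = begin
    ∑[ i < suc m ] (d i * power (suc n) i j)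
      ≡⟨ ∑-cong-< (suc m) (λ i i<k → cong (d i *_) (power-suc n i<k j<k)
                                     ⟨ trans ⟩ sym (∑-*ˡ (suc m) (d i) (λ l → power n i l * entry A l j))) ⟩
    ∑[ i < suc m ] ∑[ l < suc m ] (d i * (power n i l * entry A l j))
      ≡⟨ ∑-comm (suc m) (suc m) (λ i l → d i * (power n i l * entry A l j)) ⟩
    ∑[ l < suc m ] ∑[ i < suc m ] (d i * (power n i l * entry A l j))
      ≡⟨ ∑-cong (suc m) (λ l → ∑-cong (suc m) (λ i → sym (ℤₚ.*-assoc (d i) (power n i l) (entry A l j)))
                                ⟨ trans ⟩ ∑-*ʳ (suc m) (entry A l j) (λ i → d i * power n i l)) ⟩
    ∑[ l < suc m ] (row n l * entry A l j)
      ≡⟨ ∑-column (row n) j<k ⟩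
    atPred j (row n) + last n * T (suc m ∸ j) ∎

  row-zero : ∀ {j} → j < suc m → row 0 j ≡ d j
  row-zero = identity-⊗ʳ d

  last-zero : last 0 ≡ + suc m
  last-zero = row-zero ℕₚ.≤-refl ⟨ trans ⟩ derivCoeffs-last

  -- Iterating row-suc r times along the last column.
  last-unroll : ∀ r → r ≤ m → ∀ N → last (N ℕ.+ r) ≡ row N (m ∸ r) + ∑[ l < r ] (last (N ℕ.+ r ∸ suc l) * T (suc l))
  last-unroll zero    _   N = cong last (ℕₚ.+-identityʳ N) ⟨ trans ⟩ sym (ℤₚ.+-identityʳ (last N))
  last-unroll (suc r) r<m N = begin
    last (N ℕ.+ suc r)                          ≡⟨ cong last (ℕₚ.+-suc N r) ⟩
    last (suc N ℕ.+ r)                          ≡⟨ last-unroll r (ℕₚ.<⇒≤ r<m) (suc N) ⟩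
    row (suc N) (m ∸ r) + S                     ≡⟨ cong (λ j → row (suc N) j + S) (ℕₚ.+-∸-assoc 1 r<m) ⟩
    row (suc N) (suc (m ∸ suc r)) + S           ≡⟨ cong (_+ S) (row-suc N (s≤s (ℕₚ.∸-monoʳ-< {m} {suc r} {0} (s≤s z≤n) r<m))) ⟩
    (row N (m ∸ suc r) + last N * T (m ∸ (m ∸ suc r))) + S
      ≡⟨ cong (λ j → (row N (m ∸ suc r) + last N * T j) + S) (ℕₚ.m∸[m∸n]≡n r<m) ⟩
    (row N (m ∸ suc r) + last N * T (suc r)) + S ≡⟨ swap-last (row N (m ∸ suc r)) (last N * T (suc r)) S ⟩
    row N (m ∸ suc r) + (S + last N * T (suc r))
      ≡⟨ cong₂ (λ x y → row N (m ∸ suc r) + (x + last y * T (suc r)))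
           (∑-cong r (λ l → cong (λ z → last (z ∸ suc l) * T (suc l)) (sym (ℕₚ.+-suc N r))))
           (sym (ℕₚ.m+n∸n≡m N (suc r))) ⟩
    row N (m ∸ suc r) + (∑[ l < r ] (last (N ℕ.+ suc r ∸ suc l) * T (suc l)) + last (N ℕ.+ suc r ∸ suc r) * T (suc r))
      ≡⟨ cong (_+_ (row N (m ∸ suc r))) (sym (∑-last r (λ l → last (N ℕ.+ suc r ∸ suc l) * T (suc l)))) ⟩
    row N (m ∸ suc r) + ∑[ l < suc r ] (last (N ℕ.+ suc r ∸ suc l) * T (suc l)) ∎
    where
    S = ∑[ l < r ] (last (suc N ℕ.+ r ∸ suc l) * T (suc l))
    swap-last : ∀ a b c → (a + b) + c ≡ a + (c + b)
    swap-last = solve-∀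

  ∑-last-convolution : ∀ n →
    ∑[ l < suc n ] (last (n ∸ l) * T (suc l)) ≡ ∑[ i < n ] (T (suc i) * last (n ∸ i)) + + suc m * T (suc n)
  ∑-last-convolution n = ∑-last n (λ l → last (n ∸ l) * T (suc l)) ⟨ trans ⟩ cong₂ _+_
    (∑-cong n (λ l → ℤₚ.*-comm (last (n ∸ l)) (T (suc l))))
    (cong (λ x → last x * T (suc n)) (ℕₚ.n∸n≡0 n) ⟨ trans ⟩ cong (_* T (suc n)) last-zero)

  last-newton-≤ : ∀ n → suc n ≤ m → last (suc n) ≡ ∑[ i < n ] (T (suc i) * last (n ∸ i)) + + suc n * T (suc n)
  last-newton-≤ n n<m = begin
    last (suc n)                                      ≡⟨ last-unroll (suc n) n<m 0 ⟩
    row 0 (m ∸ suc n) + ∑[ l < suc n ] (last (n ∸ l) * T (suc l))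
      ≡⟨ cong₂ _+_ (row-zero (s≤s (ℕₚ.m∸n≤m m (suc n))) ⟨ trans ⟩ derivCoeffs-< m∸[1+n]<m
                     ⟨ trans ⟩ cong (λ x → - (+ suc (m ∸ suc n) * T x)) (ℕₚ.m∸[m∸n]≡n n<m))
                   (∑-last-convolution n) ⟩
    - (+ c * T (suc n)) + (S + + suc m * T (suc n))
      ≡⟨ cong (λ x → - (+ c * T (suc n)) + (S + x * T (suc n)))
           (cong (+_ ∘ suc) (sym (ℕₚ.m∸n+n≡m n<m)) ⟨ trans ⟩ ℤₚ.pos-+ c (suc n)) ⟩
    - (+ c * T (suc n)) + (S + (+ c + + suc n) * T (suc n)) ≡⟨ cancel (+ c) (T (suc n)) S (+ suc n) ⟩
    S + + suc n * T (suc n) ∎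
    where
    c = suc (m ∸ suc n)
    S = ∑[ i < n ] (T (suc i) * last (n ∸ i))
    m∸[1+n]<m : m ∸ suc n < m
    m∸[1+n]<m = ℕₚ.∸-monoʳ-< {m} {suc n} {0} (s≤s z≤n) n<m
    cancel : ∀ a x s b → - (a * x) + (s + (a + b) * x) ≡ s + b * x
    cancel = solve-∀

  last-newton-> : ∀ n → m ≤ n → last (suc n) ≡ ∑[ i < n ] (T (suc i) * last (n ∸ i)) + + suc n * T (suc n)
  last-newton-> n m≤n = begin
    last (suc n)                                      ≡⟨ cong last (sym [1+n∸m]+m≡1+n) ⟩
    last (suc (n ∸ m) ℕ.+ m)                          ≡⟨ last-unroll m ℕₚ.≤-refl (suc (n ∸ m)) ⟩
    row (suc (n ∸ m)) (m ∸ m) + ∑[ l < m ] (last (suc (n ∸ m) ℕ.+ m ∸ suc l) * T (suc l))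
      ≡⟨ cong₂ _+_ (cong (row (suc (n ∸ m))) (ℕₚ.n∸n≡0 m) ⟨ trans ⟩ row-suc (n ∸ m) (s≤s z≤n)
                      ⟨ trans ⟩ ℤₚ.+-identityˡ (last (n ∸ m) * T (suc m)))
                   (∑-cong m (λ l → cong (λ x → last (x ∸ suc l) * T (suc l)) [1+n∸m]+m≡1+n)) ⟩
    last (n ∸ m) * T (suc m) + ∑[ l < m ] (last (n ∸ l) * T (suc l))
      ≡⟨ ℤₚ.+-comm (last (n ∸ m) * T (suc m)) _ ⟨ trans ⟩ sym (∑-last m (λ l → last (n ∸ l) * T (suc l))) ⟩
    ∑[ l < suc m ] (last (n ∸ l) * T (suc l))
      ≡⟨ sym (∑-vanishing-tail (λ l → last (n ∸ l) * T (suc l)) (s≤s m≤n)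
           (λ l k≤l _ → cong (last (n ∸ l) *_) (coef-beyond t (suc l) (s≤s k≤l)) ⟨ trans ⟩ ℤₚ.*-zeroʳ (last (n ∸ l)))) ⟩
    ∑[ l < suc n ] (last (n ∸ l) * T (suc l))         ≡⟨ ∑-last-convolution n ⟩
    S + + suc m * T (suc n)                           ≡⟨ cong (_+_ S) [1+m]*T≡[1+n]*T ⟩
    S + + suc n * T (suc n)                           ∎
    where
    S = ∑[ i < n ] (T (suc i) * last (n ∸ i))
    [1+n∸m]+m≡1+n : suc (n ∸ m) ℕ.+ m ≡ suc n
    [1+n∸m]+m≡1+n = cong suc (ℕₚ.m∸n+n≡m m≤n)
    [1+m]*T≡[1+n]*T : + suc m * T (suc n) ≡ + suc n * T (suc n)
    [1+m]*T≡[1+n]*T with m ≟ n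
    ... | yes refl = refl
    ... | no m≢n   = cong (+ suc m *_) T≡0 ⟨ trans ⟩ ℤₚ.*-zeroʳ (+ suc m)
                     ⟨ trans ⟩ sym (cong (+ suc n *_) T≡0 ⟨ trans ⟩ ℤₚ.*-zeroʳ (+ suc n))
      where T≡0 = coef-beyond t (suc n) (s≤s (ℕₚ.≤∧≢⇒< m≤n m≢n))

  last-newton : NewtonSequence T last
  last-newton n with suc n ≤? m
  ... | yes n<m = last-newton-≤ n n<m
  ... | no  n≮m = last-newton-> n (ℕₚ.≤-pred (ℕₚ.≰⇒> n≮m))

proposition5p4 : (m : ℕ) (t : Vec ℤ (suc m)) (n : ℕ) →
    ((derivCoeffs t ·ᴹ (companion t ^ᴹ n)) (fromℕ m) / 1 ≡ G t n)
    × ((derivCoeffs t ·ᴹ (companion t ^ᴹ n)) (fromℕ m) ≡ trace (companion t ^ᴹ n))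
proposition5p4 m t n = last≡G n , (row-last≡ n ⟨ trans ⟩ sym (∑-diagonal≡last n) ⟨ trans ⟩ sym (trace≡∑ n))
  where
  open Companion t
  last≡G : ∀ n → ι ((derivCoeffs t ·ᴹ (A ^ᴹ n)) (fromℕ m)) ≡ G t n
  last≡G zero    = cong ι (row-last≡ 0 ⟨ trans ⟩ last-zero)
  last≡G (suc n) =
    cong ι (row-last≡ (suc n) ⟨ trans ⟩ newton-unique {T} {last} {Lucas.lucas t} last-newton (Lucas.lucas-newton t) n)
    ⟨ trans ⟩ sym (G≡lucas t n)
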